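{- For $n\ge1$ let $d_n:\mathfrak H[[X]]\to\mathfrak H[[X]]$ be the $\mathcal C[[X]]$-linear map \[ d_n(w)=\frac{(-\hbar)^{n-1}}{n}\left\{(\mathbf a\mathbf b^n)\sqcup\!\sqcup_q w-\mathbf a\mathbf b^n w\right\}, \] and put $D^{\sqcup\!\sqcup}_X=\sum_{n\ge1}X^nd_n$. Let $\psi(X)=\sum_{n\ge1}\frac{(-1)^{n-1}}{n}\hbar^{n-1}\mathbf a\mathbf b^nX^n$ and $\log(1+\hbar\mathbf bX)=\sum_{n\ge1}\frac{(-1)^{n-1}}{n}\hbar^n\mathbf b^nX^n$. Define $\rho_s(X)\in\mathfrak H[[X]]$ ($s\ge1$) by $\rho_1(X)=1$ and \[ \rho_{s+1}(X)=\big(\psi(X)+\log(1+\hbar\mathbf bX)\big)\rho_s(X)+\psi(X)\sqcup\!\sqcup_q\rho_s(X)\qquad(s\ge1). \] Then: (i) for all $s\ge1$ and $w\in\mathfrak H[[X]]$, $(D^{\sqcup\!\sqcup}_X)^s(w)=\big(\psi(X)\rho_s(X)\big)\sqcup\!\sqcup_q w-\psi(X)\big(\rho_s(X)\sqcup\!\sqcup_q w\big)$; (ii) for all $s\ge1$, $\psi(X)\rho_s(X)=\psi(X)^{\sqcup\!\sqcup_q s}$.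
   Context: Let $\hbar$ be a formal variable, $\mathcal{C}=\mathbb{Q}[\hbar,\hbar^{ -1}]$, and $\mathfrak{H}=\mathcal{C}\langle \mathbf{a},\mathbf{b}\rangle$ the non-commutative polynomial ring over $\mathcal{C}$. The shuffle product $\sqcup\!\sqcup_q$ is the $\mathcal{C}$-bilinear product on $\mathfrak H$ with $1\sqcup\!\sqcup_q w=w\sqcup\!\sqcup_q 1=w$, $(\mathbf a w)\sqcup\!\sqcup_q(\mathbf a w')=\mathbf a\big((\mathbf a w)\sqcup\!\sqcup_q w'+w\sqcup\!\sqcup_q(\mathbf a w')+\hbar\, w\sqcup\!\sqcup_q w'\big)$, $(\mathbf b w)\sqcup\!\sqcup_q w'=w\sqcup\!\sqcup_q(\mathbf b w')=\mathbf b(w\sqcup\!\sqcup_q w')$; it is commutative and associative. $X$ is a commuting formal variable; $\sqcup\!\sqcup_q$ is extended $\mathcal C[[X]]$-linearly to $\mathfrak H[[X]]$, and $f^{\sqcup\!\sqcup_q s}$ denotes the $s$-fold $\sqcup\!\sqcup_q$-power. Juxtaposition denotes the ordinary (concatenation) product. -}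

module Defs where

open import Data.Nat as ℕ using (ℕ; zero; suc; _∸_; NonZero)
open import Data.Integer as ℤ using (ℤ; +_; -[1+_])
open import Data.Rational as ℚ using (ℚ)
open import Data.List using (List; []; _∷_; _++_; map; replicate; concatMap)
open import Data.Product using (_×_; _,_)
open import Data.Bool using (Bool; true; false; if_then_else_; _∧_)
open import Relation.Nullary.Decidable using (⌊_⌋)
open import Relation.Binary.PropositionalEquality using (_≡_; refl)
import Data.List.Properties as LP

infixr 6 _⊕_ _⊝_ _+PS_ _-PS_
infixr 7 _·_ _⧢_ _*PS_ _⧢PS_
infix 4 _≈𝔥_ _≈_
data Letter : Set where
  𝐚 𝐛 : Letter

Word : Set
Word = List Letter

_≟L_ : (x y : Letter) → Relation.Nullary.Decidable.Dec (x ≡ y)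
𝐚 ≟L 𝐚 = Relation.Nullary.Decidable.yes refl
𝐛 ≟L 𝐛 = Relation.Nullary.Decidable.yes refl
𝐚 ≟L 𝐛 = Relation.Nullary.Decidable.no (λ ())
𝐛 ≟L 𝐚 = Relation.Nullary.Decidable.no (λ ())

_≟W_ : (u v : Word) → Relation.Nullary.Decidable.Dec (u ≡ v)
_≟W_ = LP.≡-dec _≟L_

-- 𝔥 = C⟨a,b⟩ with C = ℚ[ħ,ħ⁻¹]: finite formal ℚ-linear combinations of
-- basis elements ħ^k w (k : ℤ, w a word).  A term (q , k , w) means q ħ^k w.
Term : Set
Term = ℚ × ℤ × Word

𝔥 : Set
𝔥 = List Term

coeff : 𝔥 → Word → ℤ → ℚ
coeff [] w k = ℚ.0ℚ
coeff ((q , j , u) ∷ t) w k =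
  (if ⌊ u ≟W w ⌋ ∧ ⌊ j ℤ.≟ k ⌋ then q else ℚ.0ℚ) ℚ.+ coeff t w k

_≈𝔥_ : 𝔥 → 𝔥 → Set
x ≈𝔥 y = ∀ w k → coeff x w k ≡ coeff y w k

0𝔥 : 𝔥
0𝔥 = []

_⊕_ : 𝔥 → 𝔥 → 𝔥
x ⊕ y = x ++ y

scale : ℚ → ℤ → 𝔥 → 𝔥
scale q k = map (λ { (q' , j , u) → (q ℚ.* q' , k ℤ.+ j , u) })

⊖_ : 𝔥 → 𝔥
⊖ x = scale (ℚ.- ℚ.1ℚ) (+ 0) x

_⊝_ : 𝔥 → 𝔥 → 𝔥
x ⊝ y = x ⊕ (⊖ y)

word : Word → 𝔥
word u = (ℚ.1ℚ , + 0 , u) ∷ []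

prefix : Letter → 𝔥 → 𝔥
prefix c = map (λ { (q , j , u) → (q , j , c ∷ u) })

_·_ : 𝔥 → 𝔥 → 𝔥
x · y = concatMap (λ { (q , j , u) →
          map (λ { (q' , j' , v) → (q ℚ.* q' , j ℤ.+ j' , u ++ v) }) y }) x

-- q-shuffle of words:
--   1 ⧢ w = w ⧢ 1 = w,
--   (a u) ⧢ (a v) = a((a u) ⧢ v + u ⧢ (a v) + ħ u ⧢ v),
--   (b u) ⧢ v = u ⧢ (b v) = b(u ⧢ v).
shw : Word → Word → 𝔥
shw [] v = word v
shw (𝐛 ∷ u) v = prefix 𝐛 (shw u v)
shw (𝐚 ∷ u) v = go v
  where
  -- go v = (a u) ⧢ v
  go : Word → 𝔥
  go [] = word (𝐚 ∷ u)
  go (𝐛 ∷ v) = prefix 𝐛 (go v)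
  go (𝐚 ∷ v) = prefix 𝐚 (go v ⊕ shw u (𝐚 ∷ v) ⊕ scale ℚ.1ℚ (+ 1) (shw u v))

_⧢_ : 𝔥 → 𝔥 → 𝔥
x ⧢ y = concatMap (λ { (q , j , u) →
          concatMap (λ { (q' , j' , v) → scale (q ℚ.* q') (j ℤ.+ j') (shw u v) }) y }) x

-- 𝔥[[X]]: formal power series, f n = coefficient of X^n
PS : Set
PS = ℕ → 𝔥

_≈_ : PS → PS → Set
f ≈ g = ∀ n → f n ≈𝔥 g n

sumTo : ℕ → (ℕ → 𝔥) → 𝔥
sumTo zero f = f zero
sumTo (suc n) f = sumTo n f ⊕ f (suc n)

sumBelow : ℕ → (ℕ → 𝔥) → 𝔥
sumBelow zero f = 0𝔥
sumBelow (suc n) f = sumBelow n f ⊕ f n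

1PS : PS
1PS zero = word []
1PS (suc n) = 0𝔥

_+PS_ : PS → PS → PS
(f +PS g) n = f n ⊕ g n

_-PS_ : PS → PS → PS
(f -PS g) n = f n ⊝ g n

_*PS_ : PS → PS → PS
(f *PS g) n = sumTo n (λ i → f i · g (n ∸ i))

_⧢PS_ : PS → PS → PS
(f ⧢PS g) n = sumTo n (λ i → f i ⧢ g (n ∸ i))

shPow : PS → ℕ → PS
shPow f zero = 1PS
shPow f (suc s) = f ⧢PS shPow f s

iter : (PS → PS) → ℕ → PS → PS
iter F zero w = w
iter F (suc s) w = F (iter F s w)

c : ℕ → ℚ
c m = (-[1+ 0 ] ℤ.^ m) ℚ./ suc m

𝐛^ : ℕ → Word
𝐛^ n = replicate n 𝐛

-- d_n (n ≥ 1), C[[X]]-linear, hence acting coefficientwise: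
-- d_n(w) = (-ħ)^{n-1}/n { (a b^n) ⧢ w - a b^n w }
d : (n : ℕ) → .{{NonZero n}} → PS → PS
d (suc m) w k =
  scale (c m) (+ m) ((word (𝐚 ∷ 𝐛^ (suc m)) ⧢ w k) ⊝ (word (𝐚 ∷ 𝐛^ (suc m)) · w k))

-- D_X = Σ_{n ≥ 1} X^n d_n ; coefficient of X^k is Σ_{n=1}^{k} (d_n w)_{k-n}
D : PS → PS
D w k = sumBelow k (λ j → d (suc j) w (k ∸ suc j))

ψ : PS
ψ zero = 0𝔥
ψ (suc m) = scale (c m) (+ m) (word (𝐚 ∷ 𝐛^ (suc m)))

log1+ħbX : PS
log1+ħbX zero = 0𝔥
log1+ħbX (suc m) = scale (c m) (+ suc m) (word (𝐛^ (suc m)))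

-- ρ_s (s ≥ 1); ρ 0 is an unused dummy value
ρ : ℕ → PS
ρ zero = 1PS
ρ (suc zero) = 1PS
ρ (suc (suc s)) = ((ψ +PS log1+ħbX) *PS ρ (suc s)) +PS (ψ ⧢PS ρ (suc s))

-- Elements of 𝔥 are compared through their pairings ⟪ x , g ⟫ with functionals g on the basis ħᵏw,
-- which determine all coefficients; since ⧢ and concatenation are linear in each factor, identities
-- reduce to words. Shuffling with 𝐛ᴺ is just prefixing 𝐛ᴺ, so the 𝐚𝐚-clause of the shuffle gives
--   𝐚𝐛ᴺ ⧢ 𝐚𝐛ᴹy = 𝐚𝐛ᴹ(𝐚𝐛ᴺ ⧢ y) + 𝐚𝐛ᴺ𝐚𝐛ᴹy + ħ𝐚𝐛ᴹ𝐛ᴺy,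
-- and summing against the coefficients of ψ and log(1+ħ𝐛X) yields ψ ⧢ ψu = ψ·ρ-step(u), where
-- ρ-step(u) = (ψ + log(1+ħ𝐛X))u + ψ ⧢ u is the recursion defining ρ. So ψρₛ₊₁ = ψ ⧢ ψρₛ: this is (ii).
-- For (i), the definition of dₙ gives D(w) = ψ ⧢ w − ψw. Applying this to the claimed value of Dˢ(w)
-- and using the identity above, associativity of ⧢ with left factor ψ, and
-- (log(1+ħ𝐛X)u) ⧢ w = log(1+ħ𝐛X)(u ⧢ w), the terms regroup into the claimed value of Dˢ⁺¹(w).

{-# OPTIONS --safe #-}
module Submission where

open import Defs
open import Data.Nat as ℕ using (ℕ; zero; suc; _∸_; _≤_; z≤n)
import Data.Nat.Properties as ℕP
open import Data.Integer as ℤ using (ℤ; +_)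
import Data.Integer.Properties as ℤP
import Data.Integer.Solver as ℤSolver
open import Data.Rational as ℚ using (ℚ; 0ℚ; 1ℚ; _+_; _*_; -_)
import Data.Rational.Properties as ℚP
open import Data.Rational.Solver using (module +-*-Solver)
open import Data.List using ([]; _∷_; _++_; map; concatMap)
import Data.List.Properties as ListP
open import Data.Product using (_×_; _,_)
open import Data.Bool using (true; false; if_then_else_; _∧_)
open import Relation.Nullary.Decidable using (⌊_⌋)
open import Relation.Binary.PropositionalEquality
open import Relation.Binary.Bundles using (Setoid)
open import Level using (0ℓ)
import Relation.Binary.Reasoning.Setoid as SetoidReasoning
open +-*-Solver
open ℤSolver.+-*-Solver using () renaming (solve to solveℤ; _:+_ to _ℤ:+_; _:=_ to _ℤ:=_; con to ℤcon)

-- Pairing with functionals on the basis ħᵏw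

Functional : Set
Functional = Word → ℤ → ℚ

⟪_,_⟫ : 𝔥 → Functional → ℚ
⟪ [] , g ⟫ = 0ℚ
⟪ (q , j , u) ∷ x , g ⟫ = q * g u j + ⟪ x , g ⟫

shift : ℤ → Functional → Functional
shift k g u j = g u (k ℤ.+ j)

_∘∷_ : Functional → Letter → Functional
(g ∘∷ c) u j = g (c ∷ u) j

infix 4 _≃_
record _≃_ (x y : 𝔥) : Set where
  constructor mk≃
  field pair≡ : ∀ g → ⟪ x , g ⟫ ≡ ⟪ y , g ⟫
open _≃_ public

≃-refl : ∀ {x} → x ≃ x
≃-refl = mk≃ λ g → refl

≃-sym : ∀ {x y} → x ≃ y → y ≃ x
≃-sym p = mk≃ λ g → sym (pair≡ p g)

infixr 2 _⟨≃⟩_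
_⟨≃⟩_ : ∀ {x y z} → x ≃ y → y ≃ z → x ≃ z
p ⟨≃⟩ q = mk≃ λ g → trans (pair≡ p g) (pair≡ q g)

≡⇒≃ : ∀ {x y} → x ≡ y → x ≃ y
≡⇒≃ refl = ≃-refl

pair-++ : ∀ x y g → ⟪ x ++ y , g ⟫ ≡ ⟪ x , g ⟫ + ⟪ y , g ⟫
pair-++ [] y g = sym (ℚP.+-identityˡ _)
pair-++ ((q , j , u) ∷ x) y g =
  trans (cong (_+_ (q * g u j)) (pair-++ x y g)) (sym (ℚP.+-assoc (q * g u j) _ _))

pair-cong : ∀ x {g h : Functional} → (∀ u j → g u j ≡ h u j) → ⟪ x , g ⟫ ≡ ⟪ x , h ⟫
pair-cong [] eq = refl
pair-cong ((q , j , u) ∷ x) eq = cong₂ (λ a b → q * a + b) (eq u j) (pair-cong x eq)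

pair-+ : ∀ x (g h : Functional) → ⟪ x , (λ u j → g u j + h u j) ⟫ ≡ ⟪ x , g ⟫ + ⟪ x , h ⟫
pair-+ [] g h = sym (ℚP.+-identityˡ _)
pair-+ ((q , j , u) ∷ x) g h rewrite pair-+ x g h =
  solve 5 (λ q a b c d → q :* (a :+ b) :+ (c :+ d) := q :* a :+ c :+ (q :* b :+ d)) refl
    q (g u j) (h u j) ⟪ x , g ⟫ ⟪ x , h ⟫

pair-* : ∀ x (r : ℚ) (g : Functional) → ⟪ x , (λ u j → r * g u j) ⟫ ≡ r * ⟪ x , g ⟫
pair-* [] r g = sym (ℚP.*-zeroʳ r)
pair-* ((q , j , u) ∷ x) r g rewrite pair-* x r g =
  solve 4 (λ q r a c → q :* (r :* a) :+ r :* c := r :* (q :* a :+ c)) refl q r (g u j) ⟪ x , g ⟫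

pair-0 : ∀ x → ⟪ x , (λ _ _ → 0ℚ) ⟫ ≡ 0ℚ
pair-0 [] = refl
pair-0 ((q , j , u) ∷ x) rewrite pair-0 x = trans (ℚP.+-identityʳ _) (ℚP.*-zeroʳ q)

pair-scale : ∀ q k x g → ⟪ scale q k x , g ⟫ ≡ q * ⟪ x , shift k g ⟫
pair-scale q k [] g = sym (ℚP.*-zeroʳ q)
pair-scale q k ((q₁ , j , u) ∷ x) g rewrite pair-scale q k x g =
  solve 4 (λ q a b c → q :* a :* b :+ q :* c := q :* (a :* b :+ c)) refl
    q q₁ (g u (k ℤ.+ j)) ⟪ x , shift k g ⟫

pair-prefix : ∀ c x g → ⟪ prefix c x , g ⟫ ≡ ⟪ x , g ∘∷ c ⟫
pair-prefix c [] g = refl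
pair-prefix c ((q , j , u) ∷ x) g = cong (_+_ (q * g (c ∷ u) j)) (pair-prefix c x g)

pair-word : ∀ u g → ⟪ word u , g ⟫ ≡ g u (+ 0)
pair-word u g = trans (ℚP.+-identityʳ _) (ℚP.*-identityˡ _)

pair-shift-0 : ∀ x g → ⟪ x , shift (+ 0) g ⟫ ≡ ⟪ x , g ⟫
pair-shift-0 x g = pair-cong x (λ u j → cong (g u) (ℤP.+-identityˡ j))

pair-shift-shift : ∀ x i k g → ⟪ x , shift i (shift k g) ⟫ ≡ ⟪ x , shift (k ℤ.+ i) g ⟫
pair-shift-shift x i k g = pair-cong x (λ u j → cong (g u) (sym (ℤP.+-assoc k i j)))

pair-shift-comm : ∀ x i k g → ⟪ x , shift i (shift k g) ⟫ ≡ ⟪ x , shift k (shift i g) ⟫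
pair-shift-comm x i k g =
  pair-cong x (λ u j → cong (g u) (solveℤ 3 (λ a b c → b ℤ:+ (a ℤ:+ c) ℤ:= a ℤ:+ (b ℤ:+ c)) refl i k j))

pair-⊖ : ∀ x g → ⟪ ⊖ x , g ⟫ ≡ - ⟪ x , g ⟫
pair-⊖ x g = trans (pair-scale (- 1ℚ) (+ 0) x g)
  (trans (cong (- 1ℚ *_) (pair-shift-0 x g)) (solve 1 (λ a → :- con 1ℚ :* a := :- a) refl _))

sumTerms : 𝔥 → (Term → ℚ) → ℚ
sumTerms [] A = 0ℚ
sumTerms (t ∷ x) A = A t + sumTerms x A

sumTerms-cong : ∀ x {A B : Term → ℚ} → (∀ t → A t ≡ B t) → sumTerms x A ≡ sumTerms x B
sumTerms-cong [] eq = refl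
sumTerms-cong (t ∷ x) eq = cong₂ _+_ (eq t) (sumTerms-cong x eq)

sumTerms-* : ∀ x (r : ℚ) (A : Term → ℚ) → sumTerms x (λ t → r * A t) ≡ r * sumTerms x A
sumTerms-* [] r A = sym (ℚP.*-zeroʳ r)
sumTerms-* (t ∷ x) r A rewrite sumTerms-* x r A = sym (ℚP.*-distribˡ-+ r (A t) _)

sumTerms-pair : ∀ x (g : Functional) →
  sumTerms x (λ { (q , j , u) → q * g u j }) ≡ ⟪ x , g ⟫
sumTerms-pair [] g = refl
sumTerms-pair ((q , j , u) ∷ x) g = cong (_+_ (q * g u j)) (sumTerms-pair x g)

pair-concatMap : ∀ (f : Term → 𝔥) x g → ⟪ concatMap f x , g ⟫ ≡ sumTerms x (λ t → ⟪ f t , g ⟫)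
pair-concatMap f [] g = refl
pair-concatMap f (t ∷ x) g = trans (pair-++ (f t) _ g) (cong (_+_ ⟪ f t , g ⟫) (pair-concatMap f x g))

pair-map : ∀ (f : Term → Term) x g → ⟪ map f x , g ⟫ ≡ sumTerms x (λ t → ⟪ f t ∷ [] , g ⟫)
pair-map f [] g = refl
pair-map f (t ∷ x) g with f t
... | q , j , u = cong₂ _+_ (sym (ℚP.+-identityʳ (q * g u j))) (pair-map f x g)

pair-⧢ : ∀ x y g →
  ⟪ x ⧢ y , g ⟫ ≡ ⟪ x , (λ u j → ⟪ y , (λ v k → ⟪ shw u v , shift (j ℤ.+ k) g ⟫) ⟫) ⟫
pair-⧢ x y g =
  trans (pair-concatMap _ x g) (trans (sumTerms-cong x (λ { (q , j , u) → row q j u })) (sumTerms-pair x _))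
  where
  row : ∀ q j u → ⟪ concatMap (λ { (q′ , k , v) → scale (q * q′) (j ℤ.+ k) (shw u v) }) y , g ⟫ ≡
                  q * ⟪ y , (λ v k → ⟪ shw u v , shift (j ℤ.+ k) g ⟫) ⟫
  row q j u = trans (pair-concatMap _ y g)
    (trans (sumTerms-cong y (λ { (q′ , k , v) → entry q′ k v }))
      (trans (sumTerms-* y q _) (cong (q *_) (sumTerms-pair y _))))
    where
    entry : ∀ q′ k v → ⟪ scale (q * q′) (j ℤ.+ k) (shw u v) , g ⟫ ≡ q * (q′ * ⟪ shw u v , shift (j ℤ.+ k) g ⟫)
    entry q′ k v = trans (pair-scale (q * q′) (j ℤ.+ k) (shw u v) g) (ℚP.*-assoc q q′ _)

pair-· : ∀ x y g → ⟪ x · y , g ⟫ ≡ ⟪ x , (λ u j → ⟪ y , (λ v k → g (u ++ v) (j ℤ.+ k)) ⟫) ⟫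
pair-· x y g =
  trans (pair-concatMap _ x g) (trans (sumTerms-cong x (λ { (q , j , u) → row q j u })) (sumTerms-pair x _))
  where
  row : ∀ q j u → ⟪ map (λ { (q′ , k , v) → (q * q′ , j ℤ.+ k , u ++ v) }) y , g ⟫ ≡
                  q * ⟪ y , (λ v k → g (u ++ v) (j ℤ.+ k)) ⟫
  row q j u = trans (pair-map _ y g)
    (trans (sumTerms-cong y (λ { (q′ , k , v) → entry q′ k v }))
      (trans (sumTerms-* y q _) (cong (q *_) (sumTerms-pair y _))))
    where
    entry : ∀ q′ k v → ⟪ (q * q′ , j ℤ.+ k , u ++ v) ∷ [] , g ⟫ ≡ q * (q′ * g (u ++ v) (j ℤ.+ k))
    entry q′ k v = trans (ℚP.+-identityʳ (q * q′ * g (u ++ v) (j ℤ.+ k))) (ℚP.*-assoc q q′ _)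

pair-swap : ∀ x y (Φ : Word → ℤ → Word → ℤ → ℚ) →
  ⟪ x , (λ u j → ⟪ y , Φ u j ⟫) ⟫ ≡ ⟪ y , (λ v k → ⟪ x , (λ u j → Φ u j v k) ⟫) ⟫
pair-swap [] y Φ = sym (pair-0 y)
pair-swap ((q , j , u) ∷ x) y Φ rewrite pair-swap x y Φ =
  sym (trans (pair-+ y (λ v k → q * Φ u j v k) (λ v k → ⟪ x , (λ u j → Φ u j v k) ⟫))
             (cong (_+ ⟪ y , (λ v k → ⟪ x , (λ u j → Φ u j v k) ⟫) ⟫) (pair-* y q (Φ u j))))

sumToℚ : ℕ → (ℕ → ℚ) → ℚ
sumToℚ zero f = f zero
sumToℚ (suc n) f = sumToℚ n f + f (suc n)

sumBelowℚ : ℕ → (ℕ → ℚ) → ℚ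
sumBelowℚ zero f = 0ℚ
sumBelowℚ (suc n) f = sumBelowℚ n f + f n

pair-sumTo : ∀ n F g → ⟪ sumTo n F , g ⟫ ≡ sumToℚ n (λ i → ⟪ F i , g ⟫)
pair-sumTo zero F g = refl
pair-sumTo (suc n) F g =
  trans (pair-++ (sumTo n F) _ g) (cong (_+ ⟪ F (suc n) , g ⟫) (pair-sumTo n F g))

pair-sumBelow : ∀ n F g → ⟪ sumBelow n F , g ⟫ ≡ sumBelowℚ n (λ i → ⟪ F i , g ⟫)
pair-sumBelow zero F g = refl
pair-sumBelow (suc n) F g =
  trans (pair-++ (sumBelow n F) _ g) (cong (_+ ⟪ F n , g ⟫) (pair-sumBelow n F g))

sumToℚ-cong : ∀ n {f h : ℕ → ℚ} → (∀ i → f i ≡ h i) → sumToℚ n f ≡ sumToℚ n h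
sumToℚ-cong zero eq = eq zero
sumToℚ-cong (suc n) eq = cong₂ _+_ (sumToℚ-cong n eq) (eq (suc n))

sumToℚ-cong≤ : ∀ n {f h : ℕ → ℚ} → (∀ i → i ≤ n → f i ≡ h i) → sumToℚ n f ≡ sumToℚ n h
sumToℚ-cong≤ zero eq = eq zero z≤n
sumToℚ-cong≤ (suc n) eq =
  cong₂ _+_ (sumToℚ-cong≤ n (λ i i≤n → eq i (ℕP.m≤n⇒m≤1+n i≤n))) (eq (suc n) ℕP.≤-refl)

sumBelowℚ-cong : ∀ n {f h : ℕ → ℚ} → (∀ i → f i ≡ h i) → sumBelowℚ n f ≡ sumBelowℚ n h
sumBelowℚ-cong zero eq = refl
sumBelowℚ-cong (suc n) eq = cong₂ _+_ (sumBelowℚ-cong n eq) (eq n)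

sumToℚ-+ : ∀ n (f h : ℕ → ℚ) → sumToℚ n (λ i → f i + h i) ≡ sumToℚ n f + sumToℚ n h
sumToℚ-+ zero f h = refl
sumToℚ-+ (suc n) f h rewrite sumToℚ-+ n f h =
  solve 4 (λ a b c d → a :+ b :+ (c :+ d) := a :+ c :+ (b :+ d)) refl
    (sumToℚ n f) (sumToℚ n h) (f (suc n)) (h (suc n))

sumBelowℚ-+ : ∀ n (f h : ℕ → ℚ) → sumBelowℚ n (λ i → f i + h i) ≡ sumBelowℚ n f + sumBelowℚ n h
sumBelowℚ-+ zero f h = sym (ℚP.+-identityˡ 0ℚ)
sumBelowℚ-+ (suc n) f h rewrite sumBelowℚ-+ n f h =
  solve 4 (λ a b c d → a :+ b :+ (c :+ d) := a :+ c :+ (b :+ d)) refl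
    (sumBelowℚ n f) (sumBelowℚ n h) (f n) (h n)

sumToℚ-neg : ∀ n (f : ℕ → ℚ) → sumToℚ n (λ i → - f i) ≡ - sumToℚ n f
sumToℚ-neg zero f = refl
sumToℚ-neg (suc n) f rewrite sumToℚ-neg n f = sym (ℚP.neg-distrib-+ (sumToℚ n f) (f (suc n)))

sumBelowℚ-neg : ∀ n (f : ℕ → ℚ) → sumBelowℚ n (λ i → - f i) ≡ - sumBelowℚ n f
sumBelowℚ-neg zero f = refl
sumBelowℚ-neg (suc n) f rewrite sumBelowℚ-neg n f = sym (ℚP.neg-distrib-+ (sumBelowℚ n f) (f n))

sumBelowℚ-0 : ∀ n → sumBelowℚ n (λ _ → 0ℚ) ≡ 0ℚ
sumBelowℚ-0 zero = refl
sumBelowℚ-0 (suc n) rewrite sumBelowℚ-0 n = refl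

sumToℚ-suc : ∀ n (f : ℕ → ℚ) → sumToℚ (suc n) f ≡ f 0 + sumToℚ n (λ i → f (suc i))
sumToℚ-suc zero f = refl
sumToℚ-suc (suc n) f rewrite sumToℚ-suc n f = ℚP.+-assoc (f 0) _ _

sumToℚ≡head+sumBelowℚ : ∀ n (f : ℕ → ℚ) → sumToℚ n f ≡ f 0 + sumBelowℚ n (λ i → f (suc i))
sumToℚ≡head+sumBelowℚ zero f = sym (ℚP.+-identityʳ (f 0))
sumToℚ≡head+sumBelowℚ (suc n) f rewrite sumToℚ≡head+sumBelowℚ n f = ℚP.+-assoc (f 0) _ _

sumTriples : ℕ → (ℕ → ℕ → ℕ → ℚ) → ℚ
sumTriples n F = sumToℚ n (λ i → sumToℚ (n ∸ i) (λ j → F i j (n ∸ i ∸ j)))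

sumTriples-cong : ∀ n {F G : ℕ → ℕ → ℕ → ℚ} → (∀ i j l → F i j l ≡ G i j l) → sumTriples n F ≡ sumTriples n G
sumTriples-cong n eq = sumToℚ-cong n (λ i → sumToℚ-cong (n ∸ i) (λ j → eq i j (n ∸ i ∸ j)))

sumTriples-+ : ∀ n (F G : ℕ → ℕ → ℕ → ℚ) →
  sumTriples n (λ i j l → F i j l + G i j l) ≡ sumTriples n F + sumTriples n G
sumTriples-+ n F G =
  trans (sumToℚ-cong n (λ i → sumToℚ-+ (n ∸ i) (λ j → F i j (n ∸ i ∸ j)) (λ j → G i j (n ∸ i ∸ j))))
    (sumToℚ-+ n _ _)

sumToℚ-nested : ∀ n (H : ℕ → ℕ → ℕ → ℚ) →
  sumToℚ n (λ i → sumToℚ i (λ j → H j (i ∸ j) (n ∸ i))) ≡ sumTriples n H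
sumToℚ-nested zero H = refl
sumToℚ-nested (suc n) H =
  begin
    sumToℚ (suc n) (λ i → sumToℚ i (λ j → H j (i ∸ j) (suc n ∸ i)))
  ≡⟨ sumToℚ-suc n _ ⟩
    H 0 0 (suc n) + sumToℚ n (λ i → sumToℚ (suc i) (λ j → H j (suc i ∸ j) (n ∸ i)))
  ≡⟨ cong (_+_ (H 0 0 (suc n))) (sumToℚ-cong n (λ i → sumToℚ-suc i (λ j → H j (suc i ∸ j) (n ∸ i)))) ⟩
    H 0 0 (suc n) + sumToℚ n (λ i → H 0 (suc i) (n ∸ i) + sumToℚ i (λ j → H′ j (i ∸ j) (n ∸ i)))
  ≡⟨ cong (_+_ (H 0 0 (suc n))) (sumToℚ-+ n (λ i → H 0 (suc i) (n ∸ i)) _) ⟩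
    H 0 0 (suc n) + (first-row + sumToℚ n (λ i → sumToℚ i (λ j → H′ j (i ∸ j) (n ∸ i))))
  ≡⟨ cong (λ z → H 0 0 (suc n) + (first-row + z)) (sumToℚ-nested n H′) ⟩
    H 0 0 (suc n) + (first-row + sumTriples n H′)
  ≡⟨ sym (ℚP.+-assoc (H 0 0 (suc n)) first-row (sumTriples n H′)) ⟩
    (H 0 0 (suc n) + first-row) + sumTriples n H′
  ≡⟨ cong (_+ sumTriples n H′) (sym (sumToℚ-suc n (λ l → H 0 l (suc n ∸ l)))) ⟩
    sumToℚ (suc n) (λ l → H 0 l (suc n ∸ l)) + sumTriples n H′
  ≡⟨ sym (sumToℚ-suc n _) ⟩
    sumTriples (suc n) H
  ∎
  where
  open ≡-Reasoning
  H′ : ℕ → ℕ → ℕ → ℚ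
  H′ j = H (suc j)
  first-row : ℚ
  first-row = sumToℚ n (λ i → H 0 (suc i) (n ∸ i))

sumToℚ-reverse : ∀ n (K : ℕ → ℕ → ℚ) → sumToℚ n (λ i → K i (n ∸ i)) ≡ sumToℚ n (λ i → K (n ∸ i) i)
sumToℚ-reverse zero K = refl
sumToℚ-reverse (suc n) K =
  begin
    sumToℚ (suc n) (λ i → K i (suc n ∸ i))
  ≡⟨ sumToℚ-suc n _ ⟩
    K 0 (suc n) + sumToℚ n (λ i → K (suc i) (n ∸ i))
  ≡⟨ cong (_+_ (K 0 (suc n))) (sumToℚ-reverse n (λ i → K (suc i))) ⟩
    K 0 (suc n) + sumToℚ n (λ i → K (suc (n ∸ i)) i)
  ≡⟨ ℚP.+-comm (K 0 (suc n)) _ ⟩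
    sumToℚ n (λ i → K (suc (n ∸ i)) i) + K 0 (suc n)
  ≡⟨ cong₂ _+_ (sumToℚ-cong≤ n (λ i i≤n → cong (λ m → K m i) (sym (ℕP.+-∸-assoc 1 i≤n))))
               (cong (λ m → K m (suc n)) (sym (ℕP.n∸n≡0 n))) ⟩
    sumToℚ (suc n) (λ i → K (suc n ∸ i) i)
  ∎
  where open ≡-Reasoning

sumTriples-swap : ∀ n (F : ℕ → ℕ → ℕ → ℚ) → sumTriples n F ≡ sumTriples n (λ i j l → F j i l)
sumTriples-swap n F =
  trans (sym (sumToℚ-nested n F))
    (trans (sumToℚ-cong n (λ a → sumToℚ-reverse a (λ x y → F x y (n ∸ a))))
      (sumToℚ-nested n (λ x y z → F y x z)))

prefix-cong : ∀ c {x y} → x ≃ y → prefix c x ≃ prefix c y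
prefix-cong c {x} {y} p =
  mk≃ λ g → trans (pair-prefix c x g) (trans (pair≡ p (g ∘∷ c)) (sym (pair-prefix c y g)))

⊕-cong : ∀ {x x′ y y′} → x ≃ x′ → y ≃ y′ → x ⊕ y ≃ x′ ⊕ y′
⊕-cong {x} {x′} {y} {y′} p q =
  mk≃ λ g → trans (pair-++ x y g) (trans (cong₂ _+_ (pair≡ p g) (pair≡ q g)) (sym (pair-++ x′ y′ g)))

pair-⊝ : ∀ x y g → ⟪ x ⊝ y , g ⟫ ≡ ⟪ x , g ⟫ + - ⟪ y , g ⟫
pair-⊝ x y g = trans (pair-++ x (⊖ y) g) (cong (_+_ ⟪ x , g ⟫) (pair-⊖ y g))

⊝-cong : ∀ {x x′ y y′} → x ≃ x′ → y ≃ y′ → x ⊝ y ≃ x′ ⊝ y′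
⊝-cong {x} {x′} {y} {y′} p q = mk≃ λ g →
  trans (pair-⊝ x y g) (trans (cong₂ (λ a b → a + - b) (pair≡ p g) (pair≡ q g)) (sym (pair-⊝ x′ y′ g)))

-- ℚ[ħ,ħ⁻¹]-linearity of Φ, stated dually: Φ acts termwise through its values on words.
record Linear (Φ : 𝔥 → 𝔥) : Set where
  constructor mkLinear
  field pair-linear : ∀ x g → ⟪ Φ x , g ⟫ ≡ ⟪ x , (λ u i → ⟪ Φ (word u) , shift i g ⟫) ⟫
open Linear public

pair-expand : ∀ x g → ⟪ x , g ⟫ ≡ ⟪ x , (λ u i → ⟪ word u , shift i g ⟫) ⟫
pair-expand x g = pair-cong x (λ u i → sym (trans (pair-word u (shift i g)) (cong (g u) (ℤP.+-identityʳ i))))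

id-linear : Linear (λ x → x)
id-linear = mkLinear pair-expand

⧢-linearʳ : ∀ x → Linear (x ⧢_)
⧢-linearʳ x = mkLinear λ y g → trans (pair-⧢ x y g) (trans (pair-swap x y _) (pair-cong y (step g)))
  where
  step : ∀ g v k → ⟪ x , (λ u j → ⟪ shw u v , shift (j ℤ.+ k) g ⟫) ⟫ ≡ ⟪ x ⧢ word v , shift k g ⟫
  step g v k = sym (trans (pair-⧢ x (word v) (shift k g)) (pair-cong x (λ u j →
    trans (pair-word v (λ v′ k′ → ⟪ shw u v′ , shift (j ℤ.+ k′) (shift k g) ⟫))
      (trans (pair-shift-shift (shw u v) (j ℤ.+ + 0) k g)
      (pair-cong (shw u v) (λ w i → cong (g w) (cong (ℤ._+ i)
        (trans (cong (ℤ._+_ k) (ℤP.+-identityʳ j)) (ℤP.+-comm k j)))))))))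

⧢-linearˡ : ∀ y → Linear (_⧢ y)
⧢-linearˡ y = mkLinear λ x g → trans (pair-⧢ x y g) (pair-cong x (step g))
  where
  step : ∀ g u j → ⟪ y , (λ v k → ⟪ shw u v , shift (j ℤ.+ k) g ⟫) ⟫ ≡ ⟪ word u ⧢ y , shift j g ⟫
  step g u j = sym (trans (pair-⧢ (word u) y (shift j g))
    (trans (pair-word u (λ u′ j′ → ⟪ y , (λ v k → ⟪ shw u′ v , shift (j′ ℤ.+ k) (shift j g) ⟫) ⟫))
    (pair-cong y (λ v k → trans (pair-shift-shift (shw u v) (+ 0 ℤ.+ k) j g)
      (pair-cong (shw u v) (λ w i → cong (g w) (cong (λ z → j ℤ.+ z ℤ.+ i) (ℤP.+-identityˡ k))))))))

·-linearʳ : ∀ x → Linear (x ·_)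
·-linearʳ x = mkLinear λ y g → trans (pair-· x y g) (trans (pair-swap x y _) (pair-cong y (step g)))
  where
  step : ∀ g v k → ⟪ x , (λ u j → g (u ++ v) (j ℤ.+ k)) ⟫ ≡ ⟪ x · word v , shift k g ⟫
  step g v k = sym (trans (pair-· x (word v) (shift k g)) (pair-cong x (λ u j →
    trans (pair-word v (λ v′ k′ → shift k g (u ++ v′) (j ℤ.+ k′)))
      (cong (g (u ++ v)) (trans (cong (ℤ._+_ k) (ℤP.+-identityʳ j)) (ℤP.+-comm k j))))))

·-linearˡ : ∀ y → Linear (_· y)
·-linearˡ y = mkLinear λ x g → trans (pair-· x y g) (pair-cong x (step g))
  where
  step : ∀ g u j → ⟪ y , (λ v k → g (u ++ v) (j ℤ.+ k)) ⟫ ≡ ⟪ word u · y , shift j g ⟫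
  step g u j = sym (trans (pair-· (word u) y (shift j g))
    (trans (pair-word u (λ u′ j′ → ⟪ y , (λ v k → shift j g (u′ ++ v) (j′ ℤ.+ k)) ⟫))
    (pair-cong y (λ v k → cong (g (u ++ v)) (cong (ℤ._+_ j) (ℤP.+-identityˡ k))))))

linear-∘ : ∀ {Φ Ψ} → Linear Φ → Linear Ψ → Linear (λ x → Φ (Ψ x))
linear-∘ {Φ} {Ψ} LΦ LΨ = mkLinear λ x g →
  trans (pair-linear LΦ (Ψ x) g) (trans (pair-linear LΨ x _) (pair-cong x (λ u i →
    trans (pair-cong (Ψ (word u)) (λ v j → sym (pair-shift-shift (Φ (word v)) j i g)))
      (sym (pair-linear LΦ (Ψ (word u)) (shift i g))))))

linear-ext : ∀ {Φ Ψ} → Linear Φ → Linear Ψ → (∀ u → Φ (word u) ≃ Ψ (word u)) → ∀ x → Φ x ≃ Ψ x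
linear-ext LΦ LΨ eq x = mk≃ λ g →
  trans (pair-linear LΦ x g)
    (trans (pair-cong x (λ u i → pair≡ (eq u) (shift i g))) (sym (pair-linear LΨ x g)))

linear-cong : ∀ {Φ} → Linear Φ → ∀ {x y} → x ≃ y → Φ x ≃ Φ y
linear-cong L {x} {y} p = mk≃ λ g → trans (pair-linear L x g) (trans (pair≡ p _) (sym (pair-linear L y g)))

linear-++ : ∀ {Φ} → Linear Φ → ∀ x y g → ⟪ Φ (x ++ y) , g ⟫ ≡ ⟪ Φ x , g ⟫ + ⟪ Φ y , g ⟫
linear-++ L x y g =
  trans (pair-linear L (x ++ y) g)
    (trans (pair-++ x y _) (sym (cong₂ _+_ (pair-linear L x g) (pair-linear L y g))))

linear-[] : ∀ {Φ} → Linear Φ → ∀ g → ⟪ Φ [] , g ⟫ ≡ 0ℚ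
linear-[] L g = pair-linear L [] g

linear-⊖ : ∀ {Φ} → Linear Φ → ∀ x g → ⟪ Φ (⊖ x) , g ⟫ ≡ - ⟪ Φ x , g ⟫
linear-⊖ L x g = trans (pair-linear L _ g) (trans (pair-⊖ x _) (cong -_ (sym (pair-linear L x g))))

linear-scale : ∀ {Φ} → Linear Φ → ∀ q k x g → ⟪ Φ (scale q k x) , g ⟫ ≡ q * ⟪ Φ x , shift k g ⟫
linear-scale {Φ} L q k x g = trans (pair-linear L _ g) (trans (pair-scale q k x _) (cong (q *_)
  (sym (trans (pair-linear L x (shift k g)) (pair-cong x (λ u i → pair-shift-shift (Φ (word u)) i k g))))))

linear-sumTo : ∀ {Φ} → Linear Φ → ∀ n F g → ⟪ Φ (sumTo n F) , g ⟫ ≡ sumToℚ n (λ i → ⟪ Φ (F i) , g ⟫)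
linear-sumTo L n F g =
  trans (pair-linear L _ g) (trans (pair-sumTo n F _) (sumToℚ-cong n (λ i → sym (pair-linear L (F i) g))))

linear-scale-≃ : ∀ {Φ Ψ} → Linear Φ → Linear Ψ → ∀ {x} → Φ x ≃ Ψ x →
  ∀ q k → Φ (scale q k x) ≃ Ψ (scale q k x)
linear-scale-≃ LΦ LΨ {x} p q k = mk≃ λ g →
  trans (linear-scale LΦ q k x g) (trans (cong (q *_) (pair≡ p (shift k g))) (sym (linear-scale LΨ q k x g)))

mulħ : 𝔥 → 𝔥
mulħ = scale 1ℚ (+ 1)

mulħ-cong : ∀ {x y} → x ≃ y → mulħ x ≃ mulħ y
mulħ-cong {x} {y} p =
  mk≃ λ g → trans (pair-scale 1ℚ (+ 1) x g) (trans (cong (1ℚ *_) (pair≡ p _)) (sym (pair-scale 1ℚ (+ 1) y g)))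

⧢-dual : 𝔥 → Functional → Functional
⧢-dual y g u j = ⟪ y , (λ v k → ⟪ shw u v , shift (j ℤ.+ k) g ⟫) ⟫

pair²-cong : ∀ x y {Φ Ψ : Word → ℤ → Word → ℤ → ℚ} → (∀ u j v k → Φ u j v k ≡ Ψ u j v k) →
  ⟪ x , (λ u j → ⟪ y , Φ u j ⟫) ⟫ ≡ ⟪ x , (λ u j → ⟪ y , Ψ u j ⟫) ⟫
pair²-cong x y eq = pair-cong x (λ u j → pair-cong y (eq u j))

pair²-+ : ∀ x y (Φ Ψ : Word → ℤ → Word → ℤ → ℚ) →
  ⟪ x , (λ u j → ⟪ y , (λ v k → Φ u j v k + Ψ u j v k) ⟫) ⟫ ≡
  ⟪ x , (λ u j → ⟪ y , Φ u j ⟫) ⟫ + ⟪ x , (λ u j → ⟪ y , Ψ u j ⟫) ⟫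
pair²-+ x y Φ Ψ = trans (pair-cong x (λ u j → pair-+ y (Φ u j) (Ψ u j))) (pair-+ x _ _)

pair²-* : ∀ x y (r : ℚ) (Φ : Word → ℤ → Word → ℤ → ℚ) →
  ⟪ x , (λ u j → ⟪ y , (λ v k → r * Φ u j v k) ⟫) ⟫ ≡ r * ⟪ x , (λ u j → ⟪ y , Φ u j ⟫) ⟫
pair²-* x y r Φ = trans (pair-cong x (λ u j → pair-* y r (Φ u j))) (pair-* x r _)

pair-shw-[]ʳ : ∀ u g → ⟪ shw u [] , g ⟫ ≡ g u (+ 0)
pair-shw-[]ʳ [] g = pair-word [] g
pair-shw-[]ʳ (𝐚 ∷ u) g = pair-word (𝐚 ∷ u) g
pair-shw-[]ʳ (𝐛 ∷ u) g = trans (pair-prefix 𝐛 (shw u []) g) (pair-shw-[]ʳ u (g ∘∷ 𝐛))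

pair-shw-𝐛ʳ : ∀ u v g → ⟪ shw u (𝐛 ∷ v) , g ⟫ ≡ ⟪ shw u v , g ∘∷ 𝐛 ⟫
pair-shw-𝐛ʳ [] v g = trans (pair-word (𝐛 ∷ v) g) (sym (pair-word v (g ∘∷ 𝐛)))
pair-shw-𝐛ʳ (𝐚 ∷ u) v g = pair-prefix 𝐛 (shw (𝐚 ∷ u) v) g
pair-shw-𝐛ʳ (𝐛 ∷ u) v g = trans (pair-prefix 𝐛 (shw u (𝐛 ∷ v)) g)
  (trans (pair-shw-𝐛ʳ u v (g ∘∷ 𝐛)) (sym (pair-prefix 𝐛 (shw u v) (g ∘∷ 𝐛))))

pair-shw-𝐚𝐚 : ∀ u v g → ⟪ shw (𝐚 ∷ u) (𝐚 ∷ v) , g ⟫ ≡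
  ⟪ shw (𝐚 ∷ u) v , g ∘∷ 𝐚 ⟫ + (⟪ shw u (𝐚 ∷ v) , g ∘∷ 𝐚 ⟫ + 1ℚ * ⟪ shw u v , shift (+ 1) (g ∘∷ 𝐚) ⟫)
pair-shw-𝐚𝐚 u v g =
  trans (pair-prefix 𝐚 (shw (𝐚 ∷ u) v ⊕ shw u (𝐚 ∷ v) ⊕ mulħ (shw u v)) g)
    (trans (pair-++ (shw (𝐚 ∷ u) v) _ (g ∘∷ 𝐚)) (cong (_+_ ⟪ shw (𝐚 ∷ u) v , g ∘∷ 𝐚 ⟫)
      (trans (pair-++ (shw u (𝐚 ∷ v)) _ (g ∘∷ 𝐚)) (cong (_+_ ⟪ shw u (𝐚 ∷ v) , g ∘∷ 𝐚 ⟫)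
        (pair-scale 1ℚ (+ 1) (shw u v) (g ∘∷ 𝐚))))))

prefix𝐛-⧢ : ∀ x y → prefix 𝐛 x ⧢ y ≃ prefix 𝐛 (x ⧢ y)
prefix𝐛-⧢ x y = mk≃ λ g →
  trans (pair-⧢ (prefix 𝐛 x) y g) (trans (pair-prefix 𝐛 x (⧢-dual y g))
    (trans (pair²-cong x y (λ u j v k → pair-prefix 𝐛 (shw u v) (shift (j ℤ.+ k) g)))
      (sym (trans (pair-prefix 𝐛 (x ⧢ y) g) (pair-⧢ x y (g ∘∷ 𝐛))))))

⧢-prefix𝐛 : ∀ x y → x ⧢ prefix 𝐛 y ≃ prefix 𝐛 (x ⧢ y)
⧢-prefix𝐛 x y = mk≃ λ g →
  trans (pair-⧢ x (prefix 𝐛 y) g)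
    (trans (pair-cong x (λ u j → pair-prefix 𝐛 y (λ v k → ⟪ shw u v , shift (j ℤ.+ k) g ⟫)))
      (trans (pair²-cong x y (λ u j v k → pair-shw-𝐛ʳ u v (shift (j ℤ.+ k) g)))
        (sym (trans (pair-prefix 𝐛 (x ⧢ y) g) (pair-⧢ x y (g ∘∷ 𝐛))))))

shuffle𝐚𝐚 : 𝔥 → 𝔥 → 𝔥
shuffle𝐚𝐚 x y = (prefix 𝐚 x ⧢ y) ⊕ (x ⧢ prefix 𝐚 y) ⊕ mulħ (x ⧢ y)

prefix𝐚-⧢-prefix𝐚 : ∀ x y → prefix 𝐚 x ⧢ prefix 𝐚 y ≃ prefix 𝐚 (shuffle𝐚𝐚 x y)
prefix𝐚-⧢-prefix𝐚 x y = mk≃ λ g → trans (lhs g) (sym (rhs g))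
  where
  α β γ : Functional → ℚ
  α g = ⟪ x , (λ u j → ⟪ y , (λ v k → ⟪ shw (𝐚 ∷ u) v , shift (j ℤ.+ k) g ∘∷ 𝐚 ⟫) ⟫) ⟫
  β g = ⟪ x , (λ u j → ⟪ y , (λ v k → ⟪ shw u (𝐚 ∷ v) , shift (j ℤ.+ k) g ∘∷ 𝐚 ⟫) ⟫) ⟫
  γ g = ⟪ x , (λ u j → ⟪ y , (λ v k → ⟪ shw u v , shift (+ 1) (shift (j ℤ.+ k) g ∘∷ 𝐚) ⟫) ⟫) ⟫
  lhs : ∀ g → ⟪ prefix 𝐚 x ⧢ prefix 𝐚 y , g ⟫ ≡ α g + (β g + 1ℚ * γ g)
  lhs g =
    trans (pair-⧢ (prefix 𝐚 x) (prefix 𝐚 y) g) (trans (pair-prefix 𝐚 x (⧢-dual (prefix 𝐚 y) g))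
      (trans (pair-cong x (λ u j → pair-prefix 𝐚 y (λ v k → ⟪ shw (𝐚 ∷ u) v , shift (j ℤ.+ k) g ⟫)))
        (trans (pair²-cong x y (λ u j v k → pair-shw-𝐚𝐚 u v (shift (j ℤ.+ k) g)))
          (trans (pair²-+ x y _ _) (cong (_+_ (α g)) (trans (pair²-+ x y _ _) (cong (_+_ (β g))
            (pair²-* x y 1ℚ (λ u j v k → ⟪ shw u v , shift (+ 1) (shift (j ℤ.+ k) g ∘∷ 𝐚) ⟫)))))))))
  rhs : ∀ g → ⟪ prefix 𝐚 (shuffle𝐚𝐚 x y) , g ⟫ ≡ α g + (β g + 1ℚ * γ g)
  rhs g =
    trans (pair-prefix 𝐚 (shuffle𝐚𝐚 x y) g)
      (trans (pair-++ (prefix 𝐚 x ⧢ y) ((x ⧢ prefix 𝐚 y) ⊕ mulħ (x ⧢ y)) (g ∘∷ 𝐚)) (cong₂ _+_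
      (trans (pair-⧢ (prefix 𝐚 x) y (g ∘∷ 𝐚)) (pair-prefix 𝐚 x (⧢-dual y (g ∘∷ 𝐚))))
      (trans (pair-++ (x ⧢ prefix 𝐚 y) (mulħ (x ⧢ y)) (g ∘∷ 𝐚)) (cong₂ _+_
        (trans (pair-⧢ x (prefix 𝐚 y) (g ∘∷ 𝐚))
          (pair-cong x (λ u j → pair-prefix 𝐚 y (λ v k → ⟪ shw u v , shift (j ℤ.+ k) (g ∘∷ 𝐚) ⟫))))
        (trans (pair-scale 1ℚ (+ 1) (x ⧢ y) (g ∘∷ 𝐚)) (cong (1ℚ *_)
          (trans (pair-⧢ x y (shift (+ 1) (g ∘∷ 𝐚)))
            (pair²-cong x y (λ u j v k → pair-cong (shw u v) (λ w i → cong (g (𝐚 ∷ w))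
              (solveℤ 3 (λ a b c → a ℤ:+ (b ℤ:+ c) ℤ:= b ℤ:+ (a ℤ:+ c)) refl (+ 1) (j ℤ.+ k) i)))))))))))

linear-shuffle𝐚𝐚 : ∀ {Φ} → Linear Φ → ∀ x y g → ⟪ Φ (shuffle𝐚𝐚 x y) , g ⟫ ≡
  ⟪ Φ (prefix 𝐚 x ⧢ y) , g ⟫ + (⟪ Φ (x ⧢ prefix 𝐚 y) , g ⟫ + 1ℚ * ⟪ Φ (x ⧢ y) , shift (+ 1) g ⟫)
linear-shuffle𝐚𝐚 {Φ} L x y g =
  trans (linear-++ L (prefix 𝐚 x ⧢ y) ((x ⧢ prefix 𝐚 y) ⊕ mulħ (x ⧢ y)) g)
    (cong (_+_ ⟪ Φ (prefix 𝐚 x ⧢ y) , g ⟫)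
      (trans (linear-++ L (x ⧢ prefix 𝐚 y) (mulħ (x ⧢ y)) g)
        (cong (_+_ ⟪ Φ (x ⧢ prefix 𝐚 y) , g ⟫) (linear-scale L 1ℚ (+ 1) (x ⧢ y) g))))

pair-word-⧢-word : ∀ u v g → ⟪ word u ⧢ word v , g ⟫ ≡ ⟪ shw u v , g ⟫
pair-word-⧢-word u v g =
  trans (pair-⧢ (word u) (word v) g) (trans (pair-word u (⧢-dual (word v) g))
    (trans (pair-word v (λ v′ k → ⟪ shw u v′ , shift (+ 0 ℤ.+ k) g ⟫)) (pair-shift-0 (shw u v) g)))

⧢-identityʳ : ∀ x → x ⧢ word [] ≃ x
⧢-identityʳ x = mk≃ λ g →
  trans (pair-linear (⧢-linearˡ (word [])) x g) (trans (pair-cong x (λ u i →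
    trans (pair-word-⧢-word u [] (shift i g))
      (trans (pair-shw-[]ʳ u (shift i g)) (sym (pair-word u (shift i g))))))
      (sym (pair-expand x g)))

⧢-identityˡ : ∀ x → word [] ⧢ x ≃ x
⧢-identityˡ x = mk≃ λ g →
  trans (pair-linear (⧢-linearʳ (word [])) x g)
    (trans (pair-cong x (λ u i → pair-word-⧢-word [] u (shift i g))) (sym (pair-expand x g)))

-- Words in 𝐛, and associativity with a first factor 𝐚𝐛ⁿ

prefix𝐛^ : ℕ → 𝔥 → 𝔥
prefix𝐛^ zero x = x
prefix𝐛^ (suc n) x = prefix 𝐛 (prefix𝐛^ n x)

prefix𝐛^-cong : ∀ n {x y} → x ≃ y → prefix𝐛^ n x ≃ prefix𝐛^ n y
prefix𝐛^-cong zero p = p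
prefix𝐛^-cong (suc n) p = prefix-cong 𝐛 (prefix𝐛^-cong n p)

pair-prefix𝐛^ : ∀ n x g → ⟪ prefix𝐛^ n x , g ⟫ ≡ ⟪ x , (λ v j → g (𝐛^ n ++ v) j) ⟫
pair-prefix𝐛^ zero x g = refl
pair-prefix𝐛^ (suc n) x g = trans (pair-prefix 𝐛 (prefix𝐛^ n x) g) (pair-prefix𝐛^ n x (g ∘∷ 𝐛))

prefix𝐛^-⧢ : ∀ n x y → prefix𝐛^ n x ⧢ y ≃ prefix𝐛^ n (x ⧢ y)
prefix𝐛^-⧢ zero x y = ≃-refl
prefix𝐛^-⧢ (suc n) x y = prefix𝐛-⧢ (prefix𝐛^ n x) y ⟨≃⟩ prefix-cong 𝐛 (prefix𝐛^-⧢ n x y)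

⧢-prefix𝐛^ : ∀ n x y → x ⧢ prefix𝐛^ n y ≃ prefix𝐛^ n (x ⧢ y)
⧢-prefix𝐛^ zero x y = ≃-refl
⧢-prefix𝐛^ (suc n) x y = ⧢-prefix𝐛 x (prefix𝐛^ n y) ⟨≃⟩ prefix-cong 𝐛 (⧢-prefix𝐛^ n x y)

word-𝐛^ : ∀ n → word (𝐛^ n) ≡ prefix𝐛^ n (word [])
word-𝐛^ zero = refl
word-𝐛^ (suc n) = cong (prefix 𝐛) (word-𝐛^ n)

pair-word-· : ∀ u x g → ⟪ word u · x , g ⟫ ≡ ⟪ x , (λ v j → g (u ++ v) j) ⟫
pair-word-· u x g =
  trans (pair-· (word u) x g) (trans (pair-word u (λ u′ j → ⟪ x , (λ v k → g (u′ ++ v) (j ℤ.+ k)) ⟫))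
    (pair-cong x (λ v j → cong (g (u ++ v)) (ℤP.+-identityˡ j))))

𝐛^-⧢ : ∀ n x → word (𝐛^ n) ⧢ x ≃ prefix𝐛^ n x
𝐛^-⧢ n x = ≡⇒≃ (cong (_⧢ x) (word-𝐛^ n)) ⟨≃⟩ prefix𝐛^-⧢ n (word []) x ⟨≃⟩ prefix𝐛^-cong n (⧢-identityˡ x)

𝐛^-· : ∀ n x → word (𝐛^ n) · x ≃ prefix𝐛^ n x
𝐛^-· n x = mk≃ λ g → trans (pair-word-· (𝐛^ n) x g) (sym (pair-prefix𝐛^ n x g))

𝐛^-⧢-assoc : ∀ n x y → (word (𝐛^ n) ⧢ x) ⧢ y ≃ word (𝐛^ n) ⧢ (x ⧢ y)
𝐛^-⧢-assoc n x y =
  linear-cong (⧢-linearˡ y) (𝐛^-⧢ n x) ⟨≃⟩ prefix𝐛^-⧢ n x y ⟨≃⟩ ≃-sym (𝐛^-⧢ n (x ⧢ y))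

𝐛^-·-⧢ : ∀ n x y → (word (𝐛^ n) · x) ⧢ y ≃ word (𝐛^ n) · (x ⧢ y)
𝐛^-·-⧢ n x y =
  linear-cong (⧢-linearˡ y) (𝐛^-· n x) ⟨≃⟩ prefix𝐛^-⧢ n x y ⟨≃⟩ ≃-sym (𝐛^-· n (x ⧢ y))

-- The 𝐚𝐚-case of the induction proving associativity for a first factor 𝐚𝐛ⁿ.
shuffle𝐚𝐚-assoc : ∀ n {y z} → let u = word (𝐛^ n) in
  (prefix 𝐚 u ⧢ prefix 𝐚 y) ⧢ z ≃ prefix 𝐚 u ⧢ (prefix 𝐚 y ⧢ z) →
  (prefix 𝐚 u ⧢ y) ⧢ prefix 𝐚 z ≃ prefix 𝐚 u ⧢ (y ⧢ prefix 𝐚 z) →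
  (prefix 𝐚 u ⧢ y) ⧢ z ≃ prefix 𝐚 u ⧢ (y ⧢ z) →
  shuffle𝐚𝐚 (shuffle𝐚𝐚 u y) z ≃ shuffle𝐚𝐚 u (shuffle𝐚𝐚 y z)
shuffle𝐚𝐚-assoc n {y} {z} assoc-𝐚y-z assoc-y-𝐚z assoc-y-z =
  mk≃ λ g → trans (lhs g) (trans (regroup g) (sym (rhs g)))
  where
  u = word (𝐛^ n)
  p = prefix 𝐚 u
  t₁ t₂ t₃ t₄ t₅ t₆ t₇ : Functional → ℚ
  t₁ g = ⟪ p ⧢ (prefix 𝐚 y ⧢ z) , g ⟫
  t₂ g = ⟪ p ⧢ (y ⧢ prefix 𝐚 z) , g ⟫
  t₃ g = ⟪ p ⧢ (y ⧢ z) , shift (+ 1) g ⟫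
  t₄ g = ⟪ u ⧢ (prefix 𝐚 y ⧢ prefix 𝐚 z) , g ⟫
  t₅ g = ⟪ u ⧢ (prefix 𝐚 y ⧢ z) , shift (+ 1) g ⟫
  t₆ g = ⟪ u ⧢ (y ⧢ prefix 𝐚 z) , shift (+ 1) g ⟫
  t₇ g = ⟪ u ⧢ (y ⧢ z) , shift (+ 1) (shift (+ 1) g) ⟫
  expand : ∀ z′ → (p ⧢ y) ⧢ z′ ≃ p ⧢ (y ⧢ z′) → ∀ g → ⟪ shuffle𝐚𝐚 u y ⧢ z′ , g ⟫ ≡
    ⟪ p ⧢ (y ⧢ z′) , g ⟫ + (⟪ u ⧢ (prefix 𝐚 y ⧢ z′) , g ⟫ + 1ℚ * ⟪ u ⧢ (y ⧢ z′) , shift (+ 1) g ⟫)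
  expand z′ assoc g = trans (linear-shuffle𝐚𝐚 (⧢-linearˡ z′) u y g) (cong₂ _+_ (pair≡ assoc g)
    (cong₂ _+_ (pair≡ (𝐛^-⧢-assoc n (prefix 𝐚 y) z′) g)
               (cong (1ℚ *_) (pair≡ (𝐛^-⧢-assoc n y z′) (shift (+ 1) g)))))
  lhs : ∀ g → ⟪ shuffle𝐚𝐚 (shuffle𝐚𝐚 u y) z , g ⟫ ≡
    t₁ g + ((t₂ g + (t₄ g + 1ℚ * t₆ g)) + 1ℚ * (t₃ g + (t₅ g + 1ℚ * t₇ g)))
  lhs g = trans (linear-shuffle𝐚𝐚 id-linear (shuffle𝐚𝐚 u y) z g) (cong₂ _+_
    (pair≡ (linear-cong (⧢-linearˡ z) (≃-sym (prefix𝐚-⧢-prefix𝐚 u y)) ⟨≃⟩ assoc-𝐚y-z) g)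
    (cong₂ _+_ (expand (prefix 𝐚 z) assoc-y-𝐚z g) (cong (1ℚ *_) (expand z assoc-y-z (shift (+ 1) g)))))
  rhs : ∀ g → ⟪ shuffle𝐚𝐚 u (shuffle𝐚𝐚 y z) , g ⟫ ≡
    (t₁ g + (t₂ g + 1ℚ * t₃ g)) + (t₄ g + 1ℚ * (t₅ g + (t₆ g + 1ℚ * t₇ g)))
  rhs g = trans (linear-shuffle𝐚𝐚 id-linear u (shuffle𝐚𝐚 y z) g) (cong₂ _+_
    (linear-shuffle𝐚𝐚 (⧢-linearʳ p) y z g)
    (cong₂ _+_ (pair≡ (linear-cong (⧢-linearʳ u) (≃-sym (prefix𝐚-⧢-prefix𝐚 y z))) g)
      (cong (1ℚ *_) (linear-shuffle𝐚𝐚 (⧢-linearʳ u) y z (shift (+ 1) g)))))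
  regroup : ∀ g → t₁ g + ((t₂ g + (t₄ g + 1ℚ * t₆ g)) + 1ℚ * (t₃ g + (t₅ g + 1ℚ * t₇ g))) ≡
                  (t₁ g + (t₂ g + 1ℚ * t₃ g)) + (t₄ g + 1ℚ * (t₅ g + (t₆ g + 1ℚ * t₇ g)))
  regroup g = solve 7 (λ a b c d e f h →
    a :+ ((b :+ (d :+ con 1ℚ :* f)) :+ con 1ℚ :* (c :+ (e :+ con 1ℚ :* h))) :=
    (a :+ (b :+ con 1ℚ :* c)) :+ (d :+ con 1ℚ :* (e :+ (f :+ con 1ℚ :* h)))) refl
    (t₁ g) (t₂ g) (t₃ g) (t₄ g) (t₅ g) (t₆ g) (t₇ g)

⧢-assoc-𝐚𝐛^-words : ∀ n v w → (word (𝐚 ∷ 𝐛^ n) ⧢ word v) ⧢ word w ≃ word (𝐚 ∷ 𝐛^ n) ⧢ (word v ⧢ word w)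
⧢-assoc-𝐚𝐛^-words n [] w =
  linear-cong (⧢-linearˡ (word w)) (⧢-identityʳ (word (𝐚 ∷ 𝐛^ n)))
    ⟨≃⟩ ≃-sym (linear-cong (⧢-linearʳ (word (𝐚 ∷ 𝐛^ n))) (⧢-identityˡ (word w)))
⧢-assoc-𝐚𝐛^-words n (𝐛 ∷ v) w =
  linear-cong (⧢-linearˡ (word w)) (⧢-prefix𝐛 p (word v))
    ⟨≃⟩ prefix𝐛-⧢ (p ⧢ word v) (word w)
    ⟨≃⟩ prefix-cong 𝐛 (⧢-assoc-𝐚𝐛^-words n v w)
    ⟨≃⟩ ≃-sym (⧢-prefix𝐛 p (word v ⧢ word w))
    ⟨≃⟩ linear-cong (⧢-linearʳ p) (≃-sym (prefix𝐛-⧢ (word v) (word w)))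
  where p = word (𝐚 ∷ 𝐛^ n)
⧢-assoc-𝐚𝐛^-words n (𝐚 ∷ v) [] =
  ⧢-identityʳ (p ⧢ word (𝐚 ∷ v)) ⟨≃⟩ ≃-sym (linear-cong (⧢-linearʳ p) (⧢-identityʳ (word (𝐚 ∷ v))))
  where p = word (𝐚 ∷ 𝐛^ n)
⧢-assoc-𝐚𝐛^-words n (𝐚 ∷ v) (𝐛 ∷ w) =
  ⧢-prefix𝐛 (p ⧢ word (𝐚 ∷ v)) (word w)
    ⟨≃⟩ prefix-cong 𝐛 (⧢-assoc-𝐚𝐛^-words n (𝐚 ∷ v) w)
    ⟨≃⟩ ≃-sym (⧢-prefix𝐛 p (word (𝐚 ∷ v) ⧢ word w))
    ⟨≃⟩ linear-cong (⧢-linearʳ p) (≃-sym (⧢-prefix𝐛 (word (𝐚 ∷ v)) (word w)))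
  where p = word (𝐚 ∷ 𝐛^ n)
⧢-assoc-𝐚𝐛^-words n (𝐚 ∷ v) (𝐚 ∷ w) =
  linear-cong (⧢-linearˡ (prefix 𝐚 (word w))) (prefix𝐚-⧢-prefix𝐚 u (word v))
    ⟨≃⟩ prefix𝐚-⧢-prefix𝐚 (shuffle𝐚𝐚 u (word v)) (word w)
    ⟨≃⟩ prefix-cong 𝐚 (shuffle𝐚𝐚-assoc n {word v} {word w} (⧢-assoc-𝐚𝐛^-words n (𝐚 ∷ v) w)
                                                         (⧢-assoc-𝐚𝐛^-words n v (𝐚 ∷ w))
                                                         (⧢-assoc-𝐚𝐛^-words n v w))
    ⟨≃⟩ ≃-sym (prefix𝐚-⧢-prefix𝐚 u (shuffle𝐚𝐚 (word v) (word w)))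
    ⟨≃⟩ linear-cong (⧢-linearʳ (prefix 𝐚 u)) (≃-sym (prefix𝐚-⧢-prefix𝐚 (word v) (word w)))
  where u = word (𝐛^ n)

⧢-assoc-𝐚𝐛^ : ∀ n x y → (word (𝐚 ∷ 𝐛^ n) ⧢ x) ⧢ y ≃ word (𝐚 ∷ 𝐛^ n) ⧢ (x ⧢ y)
⧢-assoc-𝐚𝐛^ n x y =
  linear-ext (linear-∘ (⧢-linearˡ y) (⧢-linearʳ p)) (linear-∘ (⧢-linearʳ p) (⧢-linearˡ y))
    (λ v → linear-ext (⧢-linearʳ (p ⧢ word v)) (linear-∘ (⧢-linearʳ p) (⧢-linearʳ (word v)))
             (⧢-assoc-𝐚𝐛^-words n v) y)
    x
  where p = word (𝐚 ∷ 𝐛^ n)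

ψ-⧢-assoc : ∀ i x y → (ψ i ⧢ x) ⧢ y ≃ ψ i ⧢ (x ⧢ y)
ψ-⧢-assoc zero x y = ≃-refl
ψ-⧢-assoc (suc m) x y =
  linear-scale-≃ (linear-∘ (⧢-linearˡ y) (⧢-linearˡ x)) (⧢-linearˡ (x ⧢ y)) {word (𝐚 ∷ 𝐛^ (suc m))}
    (⧢-assoc-𝐚𝐛^ (suc m) x y) (c m) (+ m)

log-·-⧢ : ∀ i x y → (log1+ħbX i · x) ⧢ y ≃ log1+ħbX i · (x ⧢ y)
log-·-⧢ zero x y = ≃-refl
log-·-⧢ (suc m) x y =
  linear-scale-≃ (linear-∘ (⧢-linearˡ y) (·-linearˡ x)) (·-linearˡ (x ⧢ y)) {word (𝐛^ (suc m))}
    (𝐛^-·-⧢ (suc m) x y) (c m) (+ suc m)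

-- The shuffle of 𝐚𝐛ᴺ with 𝐚𝐛ᴹy

prefix-mulħ : ∀ c x → prefix c (mulħ x) ≃ mulħ (prefix c x)
prefix-mulħ c x = mk≃ λ g →
  trans (pair-prefix c (mulħ x) g) (trans (pair-scale 1ℚ (+ 1) x (g ∘∷ c))
    (sym (trans (pair-scale 1ℚ (+ 1) (prefix c x) g) (cong (1ℚ *_) (pair-prefix c x (shift (+ 1) g))))))

prefix𝐛^-+ : ∀ m n x → prefix𝐛^ m (prefix𝐛^ n x) ≡ prefix𝐛^ (m ℕ.+ n) x
prefix𝐛^-+ zero n x = refl
prefix𝐛^-+ (suc m) n x = cong (prefix 𝐛) (prefix𝐛^-+ m n x)

prefix𝐛^-comm : ∀ m n x → prefix𝐛^ m (prefix𝐛^ n x) ≡ prefix𝐛^ n (prefix𝐛^ m x)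
prefix𝐛^-comm m n x =
  trans (prefix𝐛^-+ m n x) (trans (cong (λ k → prefix𝐛^ k x) (ℕP.+-comm m n)) (sym (prefix𝐛^-+ n m x)))

𝐚𝐛^-· : ∀ n x → word (𝐚 ∷ 𝐛^ n) · x ≃ prefix 𝐚 (prefix𝐛^ n x)
𝐚𝐛^-· n x = mk≃ λ g →
  trans (pair-word-· (𝐚 ∷ 𝐛^ n) x g)
    (sym (trans (pair-prefix 𝐚 (prefix𝐛^ n x) g) (pair-prefix𝐛^ n x (g ∘∷ 𝐚))))

𝐚𝐛^-⧢-𝐚𝐛^· : ∀ N M y → let p = word (𝐚 ∷ 𝐛^ N); q = word (𝐚 ∷ 𝐛^ M) in
  p ⧢ (q · y) ≃ q · (p ⧢ y) ⊕ (p · (q · y) ⊕ mulħ (q · (word (𝐛^ N) · y)))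
𝐚𝐛^-⧢-𝐚𝐛^· N M y =
  linear-cong (⧢-linearʳ p) (𝐚𝐛^-· M y)
    ⟨≃⟩ prefix𝐚-⧢-prefix𝐚 u y′
    ⟨≃⟩ ≡⇒≃ (trans (ListP.map-++ _ (p ⧢ y′) _)
                    (cong (prefix 𝐚 (p ⧢ y′) ++_) (ListP.map-++ _ (u ⧢ prefix 𝐚 y′) _)))
    ⟨≃⟩ ⊕-cong first (⊕-cong second third)
  where
  u = word (𝐛^ N)
  p = word (𝐚 ∷ 𝐛^ N)
  q = word (𝐚 ∷ 𝐛^ M)
  y′ = prefix𝐛^ M y
  first : prefix 𝐚 (p ⧢ y′) ≃ q · (p ⧢ y)
  first = prefix-cong 𝐚 (⧢-prefix𝐛^ M p y) ⟨≃⟩ ≃-sym (𝐚𝐛^-· M (p ⧢ y))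
  second : prefix 𝐚 (u ⧢ prefix 𝐚 y′) ≃ p · (q · y)
  second = prefix-cong 𝐚 (𝐛^-⧢ N (prefix 𝐚 y′)) ⟨≃⟩ ≃-sym (𝐚𝐛^-· N (prefix 𝐚 y′))
    ⟨≃⟩ linear-cong (·-linearʳ p) (≃-sym (𝐚𝐛^-· M y))
  third : prefix 𝐚 (mulħ (u ⧢ y′)) ≃ mulħ (q · (u · y))
  third = prefix-mulħ 𝐚 (u ⧢ y′) ⟨≃⟩ mulħ-cong (prefix-cong 𝐚 (𝐛^-⧢ N y′
    ⟨≃⟩ ≡⇒≃ (prefix𝐛^-comm N M y) ⟨≃⟩ prefix𝐛^-cong M (≃-sym (𝐛^-· N y))) ⟨≃⟩ ≃-sym (𝐚𝐛^-· M (u · y)))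

ψ-⧢-ψ· : ∀ i j y → ψ i ⧢ (ψ j · y) ≃ ψ j · (ψ i ⧢ y) ⊕ (ψ i · (ψ j · y) ⊕ ψ j · (log1+ħbX i · y))
ψ-⧢-ψ· zero zero y = ≃-refl
ψ-⧢-ψ· zero (suc m) y = ≃-refl
ψ-⧢-ψ· (suc n) zero y = ≃-refl
ψ-⧢-ψ· (suc n) (suc m) y = mk≃ λ g →
  begin
    ⟪ ψ (suc n) ⧢ (ψ (suc m) · y) , g ⟫
  ≡⟨ linear-scale (⧢-linearˡ (ψ (suc m) · y)) (c n) (+ n) p g ⟩
    c n * ⟪ p ⧢ (ψ (suc m) · y) , shift (+ n) g ⟫
  ≡⟨ cong (c n *_) (linear-scale (linear-∘ (⧢-linearʳ p) (·-linearˡ y)) (c m) (+ m) q (shift (+ n) g)) ⟩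
    c n * (c m * ⟪ p ⧢ (q · y) , h g ⟫)
  ≡⟨ cong (λ z → c n * (c m * z)) (pair≡ (𝐚𝐛^-⧢-𝐚𝐛^· (suc n) (suc m) y) (h g)) ⟩
    c n * (c m * ⟪ q · (p ⧢ y) ⊕ (p · (q · y) ⊕ mulħ (q · (u · y))) , h g ⟫)
  ≡⟨ cong (λ z → c n * (c m * z)) (trans (pair-++ (q · (p ⧢ y)) _ (h g)) (cong (_+_ (a₁ g))
       (trans (pair-++ (p · (q · y)) _ (h g))
         (cong (_+_ (a₂ g)) (pair-scale 1ℚ (+ 1) (q · (u · y)) (h g)))))) ⟩
    c n * (c m * (a₁ g + (a₂ g + 1ℚ * a₃ g)))
  ≡⟨ solve 5 (λ cn cm x y z → cn :* (cm :* (x :+ (y :+ con 1ℚ :* z))) :=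
                              cm :* (cn :* x) :+ (cn :* (cm :* y) :+ cm :* (cn :* z))) refl
       (c n) (c m) (a₁ g) (a₂ g) (a₃ g) ⟩
    c m * (c n * a₁ g) + (c n * (c m * a₂ g) + c m * (c n * a₃ g))
  ≡⟨ sym (trans (pair-++ (ψ (suc m) · (ψ (suc n) ⧢ y)) _ g) (cong₂ _+_ (first g)
       (trans (pair-++ (ψ (suc n) · (ψ (suc m) · y)) _ g) (cong₂ _+_ (second g) (third g))))) ⟩
    ⟪ ψ (suc m) · (ψ (suc n) ⧢ y) ⊕ (ψ (suc n) · (ψ (suc m) · y) ⊕ ψ (suc m) · (log1+ħbX (suc n) · y)) , g ⟫
  ∎
  where
  open ≡-Reasoning
  u = word (𝐛^ (suc n))
  p = word (𝐚 ∷ 𝐛^ (suc n))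
  q = word (𝐚 ∷ 𝐛^ (suc m))
  h : Functional → Functional
  h g = shift (+ m) (shift (+ n) g)
  a₁ a₂ a₃ : Functional → ℚ
  a₁ g = ⟪ q · (p ⧢ y) , h g ⟫
  a₂ g = ⟪ p · (q · y) , h g ⟫
  a₃ g = ⟪ q · (u · y) , shift (+ 1) (h g) ⟫
  first : ∀ g → ⟪ ψ (suc m) · (ψ (suc n) ⧢ y) , g ⟫ ≡ c m * (c n * a₁ g)
  first g = trans (linear-scale (·-linearˡ (ψ (suc n) ⧢ y)) (c m) (+ m) q g) (cong (c m *_)
    (trans (linear-scale (linear-∘ (·-linearʳ q) (⧢-linearˡ y)) (c n) (+ n) p (shift (+ m) g))
      (cong (c n *_) (pair-shift-comm (q · (p ⧢ y)) (+ n) (+ m) g))))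
  second : ∀ g → ⟪ ψ (suc n) · (ψ (suc m) · y) , g ⟫ ≡ c n * (c m * a₂ g)
  second g = trans (linear-scale (·-linearˡ (ψ (suc m) · y)) (c n) (+ n) p g) (cong (c n *_)
    (linear-scale (linear-∘ (·-linearʳ p) (·-linearˡ y)) (c m) (+ m) q (shift (+ n) g)))
  -- The ħ from the 𝐚𝐚-clause supplies the extra power in the coefficient ħⁿ⁺¹ of log(1+ħ𝐛X).
  third : ∀ g → ⟪ ψ (suc m) · (log1+ħbX (suc n) · y) , g ⟫ ≡ c m * (c n * a₃ g)
  third g = trans (linear-scale (·-linearˡ (log1+ħbX (suc n) · y)) (c m) (+ m) q g) (cong (c m *_)
    (trans (linear-scale (linear-∘ (·-linearʳ q) (·-linearˡ y)) (c n) (+ suc n) u (shift (+ m) g))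
      (cong (c n *_) (pair-cong (q · (u · y)) (λ w j → cong (g w)
        (solveℤ 3 (λ a b x → b ℤ:+ ((ℤcon (+ 1) ℤ:+ a) ℤ:+ x) ℤ:= a ℤ:+ (b ℤ:+ (ℤcon (+ 1) ℤ:+ x))) refl
          (+ n) (+ m) j))))))

-- Formal power series

infix 4 _≋_
record _≋_ (f h : PS) : Set where
  constructor mk≋
  field coeff≃ : ∀ n → f n ≃ h n
open _≋_ public

≋-refl : ∀ {f} → f ≋ f
≋-refl = mk≋ λ n → ≃-refl

≋-sym : ∀ {f h} → f ≋ h → h ≋ f
≋-sym p = mk≋ λ n → ≃-sym (coeff≃ p n)

≋-trans : ∀ {f h k} → f ≋ h → h ≋ k → f ≋ k
≋-trans p q = mk≋ λ n → coeff≃ p n ⟨≃⟩ coeff≃ q n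

≋-setoid : Setoid 0ℓ 0ℓ
≋-setoid = record
  { Carrier = PS
  ; _≈_ = _≋_
  ; isEquivalence = record { refl = ≋-refl ; sym = ≋-sym ; trans = ≋-trans }
  }

+PS-cong : ∀ {f f′ h h′} → f ≋ f′ → h ≋ h′ → f +PS h ≋ f′ +PS h′
+PS-cong p q = mk≋ λ n → ⊕-cong (coeff≃ p n) (coeff≃ q n)

-PS-cong : ∀ {f f′ h h′} → f ≋ f′ → h ≋ h′ → f -PS h ≋ f′ -PS h′
-PS-cong p q = mk≋ λ n → ⊝-cong (coeff≃ p n) (coeff≃ q n)

+PS-assoc : ∀ f h k → (f +PS h) +PS k ≋ f +PS (h +PS k)
+PS-assoc f h k = mk≋ λ n → ≡⇒≃ (ListP.++-assoc (f n) (h n) (k n))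

-PS-cancel : ∀ a p q r m → (a -PS ((p +PS q) +PS r)) -PS (m -PS p) ≋ a -PS (m +PS (q +PS r))
-PS-cancel a p q r m = mk≋ λ n → mk≃ λ g →
  trans (pair-⊝ (a n ⊝ ((p n ⊕ q n) ⊕ r n)) (m n ⊝ p n) g)
    (trans (cong₂ (λ x y → x + - y)
      (trans (pair-⊝ (a n) _ g) (cong (λ z → ⟪ a n , g ⟫ + - z)
        (trans (pair-++ (p n ⊕ q n) (r n) g) (cong (_+ ⟪ r n , g ⟫) (pair-++ (p n) (q n) g)))))
      (pair-⊝ (m n) (p n) g))
    (trans (solve 5 (λ a p q r m →
                       (a :+ :- ((p :+ q) :+ r)) :+ :- (m :+ :- p) := a :+ :- (m :+ (q :+ r))) refl
             ⟪ a n , g ⟫ ⟪ p n , g ⟫ ⟪ q n , g ⟫ ⟪ r n , g ⟫ ⟪ m n , g ⟫)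
    (sym (trans (pair-⊝ (a n) _ g) (cong (λ z → ⟪ a n , g ⟫ + - z)
      (trans (pair-++ (m n) _ g) (cong (_+_ ⟪ m n , g ⟫) (pair-++ (q n) (r n) g))))))))

convolution : (𝔥 → 𝔥 → 𝔥) → PS → PS → PS
convolution _∙_ f h n = sumTo n (λ i → f i ∙ h (n ∸ i))

module Convolution (_∙_ : 𝔥 → 𝔥 → 𝔥) (∙-linearʳ : ∀ x → Linear (x ∙_)) (∙-linearˡ : ∀ y → Linear (_∙ y)) where

  _⊛_ : PS → PS → PS
  _⊛_ = convolution _∙_

  ⊛-congʳ : ∀ f {h h′} → h ≋ h′ → f ⊛ h ≋ f ⊛ h′
  ⊛-congʳ f p = mk≋ λ n → mk≃ λ g → trans (pair-sumTo n _ g)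
    (trans (sumToℚ-cong n (λ i → pair≡ (linear-cong (∙-linearʳ (f i)) (coeff≃ p (n ∸ i))) g))
      (sym (pair-sumTo n _ g)))

  ⊛-congˡ : ∀ h {f f′} → f ≋ f′ → f ⊛ h ≋ f′ ⊛ h
  ⊛-congˡ h p = mk≋ λ n → mk≃ λ g → trans (pair-sumTo n _ g)
    (trans (sumToℚ-cong n (λ i → pair≡ (linear-cong (∙-linearˡ (h (n ∸ i))) (coeff≃ p i)) g))
      (sym (pair-sumTo n _ g)))

  ⊛-distribˡ-+PS : ∀ f h k → f ⊛ (h +PS k) ≋ (f ⊛ h) +PS (f ⊛ k)
  ⊛-distribˡ-+PS f h k = mk≋ λ n → mk≃ λ g →
    trans (pair-sumTo n _ g)
      (trans (sumToℚ-cong n (λ i → linear-++ (∙-linearʳ (f i)) (h (n ∸ i)) (k (n ∸ i)) g))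
        (trans (sumToℚ-+ n _ _)
          (sym (trans (pair-++ ((f ⊛ h) n) _ g) (cong₂ _+_ (pair-sumTo n _ g) (pair-sumTo n _ g))))))

  ⊛-distribʳ-+PS : ∀ h f f′ → (f +PS f′) ⊛ h ≋ (f ⊛ h) +PS (f′ ⊛ h)
  ⊛-distribʳ-+PS h f f′ = mk≋ λ n → mk≃ λ g →
    trans (pair-sumTo n _ g)
      (trans (sumToℚ-cong n (λ i → linear-++ (∙-linearˡ (h (n ∸ i))) (f i) (f′ i) g))
        (trans (sumToℚ-+ n _ _)
          (sym (trans (pair-++ ((f ⊛ h) n) _ g) (cong₂ _+_ (pair-sumTo n _ g) (pair-sumTo n _ g))))))

  ⊛-distribˡ--PS : ∀ f h k → f ⊛ (h -PS k) ≋ (f ⊛ h) -PS (f ⊛ k)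
  ⊛-distribˡ--PS f h k = mk≋ λ n → mk≃ (pairing n)
    where
    pairing : ∀ n g → ⟪ (f ⊛ (h -PS k)) n , g ⟫ ≡ ⟪ ((f ⊛ h) -PS (f ⊛ k)) n , g ⟫
    pairing n g =
      begin
        ⟪ (f ⊛ (h -PS k)) n , g ⟫
      ≡⟨ pair-sumTo n _ g ⟩
        sumToℚ n (λ i → ⟪ f i ∙ (h (n ∸ i) ⊝ k (n ∸ i)) , g ⟫)
      ≡⟨ sumToℚ-cong n (λ i → trans (linear-++ (∙-linearʳ (f i)) (h (n ∸ i)) (⊖ k (n ∸ i)) g)
                                    (cong (_+_ (A i)) (linear-⊖ (∙-linearʳ (f i)) (k (n ∸ i)) g))) ⟩
        sumToℚ n (λ i → A i + - B i)
      ≡⟨ trans (sumToℚ-+ n A (λ i → - B i)) (cong (_+_ (sumToℚ n A)) (sumToℚ-neg n B)) ⟩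
        sumToℚ n A + - sumToℚ n B
      ≡⟨ sym (trans (pair-⊝ ((f ⊛ h) n) _ g) (cong₂ (λ a b → a + - b) (pair-sumTo n _ g) (pair-sumTo n _ g))) ⟩
        ⟪ ((f ⊛ h) -PS (f ⊛ k)) n , g ⟫
      ∎
      where
      open ≡-Reasoning
      A B : ℕ → ℚ
      A i = ⟪ f i ∙ h (n ∸ i) , g ⟫
      B i = ⟪ f i ∙ k (n ∸ i) , g ⟫

  ⊛-identityʳ : (∀ x → x ∙ word [] ≃ x) → ∀ f → f ⊛ 1PS ≋ f
  ⊛-identityʳ ∙-identityʳ f = mk≋ λ n → mk≃ λ g →
    trans (pair-sumTo n _ g) (trans (sumToℚ-reverse n (λ i j → ⟪ f i ∙ 1PS j , g ⟫))
      (trans (sumToℚ≡head+sumBelowℚ n _)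
        (trans (cong₂ _+_ (pair≡ (∙-identityʳ (f n)) g)
                          (trans (sumBelowℚ-cong n (λ i → linear-[] (∙-linearʳ (f (n ∸ suc i))) g))
                                 (sumBelowℚ-0 n)))
          (ℚP.+-identityʳ _))))

pair-convolution-nested : ∀ {_∙_} → (∀ x → Linear (x ∙_)) → ∀ _∘_ f h k n g →
  ⟪ convolution _∙_ f (convolution _∘_ h k) n , g ⟫ ≡ sumTriples n (λ i j l → ⟪ f i ∙ (h j ∘ k l) , g ⟫)
pair-convolution-nested ∙-linearʳ _∘_ f h k n g = trans (pair-sumTo n _ g)
  (sumToℚ-cong n (λ i → linear-sumTo (∙-linearʳ (f i)) (n ∸ i) (λ j → h j ∘ k (n ∸ i ∸ j)) g))

convolution-assoc : ∀ _∙_ _∘_ _⋆_ _◇_ → (∀ y → Linear (_∘ y)) → (∀ x → Linear (x ⋆_)) →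
  ∀ f h k → (∀ i x y → (f i ∙ x) ∘ y ≃ f i ⋆ (x ◇ y)) →
  convolution _∘_ (convolution _∙_ f h) k ≋ convolution _⋆_ f (convolution _◇_ h k)
convolution-assoc _∙_ _∘_ _⋆_ _◇_ ∘-linearˡ ⋆-linearʳ f h k assoc = mk≋ λ n → mk≃ λ g →
  trans (pair-sumTo n _ g)
    (trans (sumToℚ-cong n (λ a → trans (linear-sumTo (∘-linearˡ (k (n ∸ a))) a (λ j → f j ∙ h (a ∸ j)) g)
                                   (sumToℚ-cong a (λ j → pair≡ (assoc j (h (a ∸ j)) (k (n ∸ a))) g))))
      (trans (sumToℚ-nested n (λ i j l → ⟪ f i ⋆ (h j ◇ k l) , g ⟫))
        (sym (pair-convolution-nested ⋆-linearʳ _◇_ f h k n g))))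

open Convolution _⧢_ ⧢-linearʳ ⧢-linearˡ using () renaming
  ( ⊛-congʳ to ⧢PS-congʳ ; ⊛-congˡ to ⧢PS-congˡ
  ; ⊛-distribʳ-+PS to ⧢PS-distribʳ-+PS ; ⊛-distribˡ--PS to ⧢PS-distribˡ--PS )
open Convolution _·_ ·-linearʳ ·-linearˡ using () renaming
  ( ⊛-congʳ to *PS-congʳ
  ; ⊛-distribˡ-+PS to *PS-distribˡ-+PS ; ⊛-distribʳ-+PS to *PS-distribʳ-+PS
  ; ⊛-distribˡ--PS to *PS-distribˡ--PS )

·-identityʳ : ∀ x → x · word [] ≃ x
·-identityʳ x = mk≃ λ g → trans (pair-· x (word []) g) (pair-cong x (λ u j →
  trans (pair-word [] (λ v k → g (u ++ v) (j ℤ.+ k))) (cong₂ g (ListP.++-identityʳ u) (ℤP.+-identityʳ j))))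

*PS-identityʳ : ∀ f → f *PS 1PS ≋ f
*PS-identityʳ = Convolution.⊛-identityʳ _·_ ·-linearʳ ·-linearˡ ·-identityʳ

⧢PS-identityʳ : ∀ f → f ⧢PS 1PS ≋ f
⧢PS-identityʳ = Convolution.⊛-identityʳ _⧢_ ⧢-linearʳ ⧢-linearˡ ⧢-identityʳ

⧢PS-identityˡ : ∀ f → 1PS ⧢PS f ≋ f
⧢PS-identityˡ f = mk≋ λ n → mk≃ λ g →
  trans (pair-sumTo n _ g) (trans (sumToℚ≡head+sumBelowℚ n _)
    (trans (cong₂ _+_ (pair≡ (⧢-identityˡ (f n)) g) (sumBelowℚ-0 n)) (ℚP.+-identityʳ _)))

ψ⧢-⧢-assoc : ∀ u w → (ψ ⧢PS u) ⧢PS w ≋ ψ ⧢PS (u ⧢PS w)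
ψ⧢-⧢-assoc u w = convolution-assoc _⧢_ _⧢_ _⧢_ _⧢_ ⧢-linearˡ ⧢-linearʳ ψ u w ψ-⧢-assoc

log*-⧢-assoc : ∀ u w → (log1+ħbX *PS u) ⧢PS w ≋ log1+ħbX *PS (u ⧢PS w)
log*-⧢-assoc u w = convolution-assoc _·_ _⧢_ _·_ _⧢_ ⧢-linearˡ ·-linearʳ log1+ħbX u w log-·-⧢

-- ψ has no constant term.
pair-convolution-ψ : ∀ _∙_ → (∀ y → [] ∙ y ≡ []) → ∀ h n g →
  ⟪ convolution _∙_ ψ h n , g ⟫ ≡ sumBelowℚ n (λ j → ⟪ ψ (suc j) ∙ h (n ∸ suc j) , g ⟫)
pair-convolution-ψ _∙_ []∙ h n g =
  trans (pair-sumTo n _ g) (trans (sumToℚ≡head+sumBelowℚ n _)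
    (trans (cong (λ z → ⟪ z , g ⟫ + rest) ([]∙ (h n))) (ℚP.+-identityˡ rest)))
  where rest = sumBelowℚ n (λ j → ⟪ ψ (suc j) ∙ h (n ∸ suc j) , g ⟫)

pair-d : ∀ j w k g → ⟪ d (suc j) w k , g ⟫ ≡ ⟪ ψ (suc j) ⧢ w k , g ⟫ + - ⟪ ψ (suc j) · w k , g ⟫
pair-d j w k g =
  trans (pair-scale (c j) (+ j) ((p ⧢ w k) ⊝ (p · w k)) g)
    (trans (cong (c j *_) (pair-⊝ (p ⧢ w k) (p · w k) (shift (+ j) g)))
      (trans (solve 3 (λ q x y → q :* (x :+ :- y) := q :* x :+ :- (q :* y)) refl (c j) _ _)
        (sym (cong₂ (λ a b → a + - b) (linear-scale (⧢-linearˡ (w k)) (c j) (+ j) p g)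
                                      (linear-scale (·-linearˡ (w k)) (c j) (+ j) p g)))))
  where p = word (𝐚 ∷ 𝐛^ (suc j))

D≋ψ⧢-ψ* : ∀ w → D w ≋ (ψ ⧢PS w) -PS (ψ *PS w)
D≋ψ⧢-ψ* w = mk≋ λ n → mk≃ (pairing n)
  where
  shuffled concatenated : ℕ → Functional → ℕ → ℚ
  shuffled n g j = ⟪ ψ (suc j) ⧢ w (n ∸ suc j) , g ⟫
  concatenated n g j = ⟪ ψ (suc j) · w (n ∸ suc j) , g ⟫
  pairing : ∀ n g → ⟪ D w n , g ⟫ ≡ ⟪ ((ψ ⧢PS w) -PS (ψ *PS w)) n , g ⟫
  pairing n g =
    trans (pair-sumBelow n _ g)
      (trans (sumBelowℚ-cong n (λ j → pair-d j w (n ∸ suc j) g))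
        (trans (sumBelowℚ-+ n (shuffled n g) (λ j → - concatenated n g j))
          (trans (cong (_+_ (sumBelowℚ n (shuffled n g))) (sumBelowℚ-neg n (concatenated n g)))
            (sym (trans (pair-⊝ ((ψ ⧢PS w) n) ((ψ *PS w) n) g)
              (cong₂ (λ a b → a + - b) (pair-convolution-ψ _⧢_ (λ _ → refl) w n g)
                                       (pair-convolution-ψ _·_ (λ _ → refl) w n g)))))))

D-cong : ∀ {f h} → f ≋ h → D f ≋ D h
D-cong {f} {h} p =
  ≋-trans (D≋ψ⧢-ψ* f) (≋-trans (-PS-cong (⧢PS-congʳ ψ p) (*PS-congʳ ψ p)) (≋-sym (D≋ψ⧢-ψ* h)))

ρ-step : PS → PS
ρ-step u = ((ψ +PS log1+ħbX) *PS u) +PS (ψ ⧢PS u)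

ψ*ρ-step-expand : ∀ u →
  ψ *PS ρ-step u ≋ ((ψ *PS (ψ *PS u)) +PS (ψ *PS (log1+ħbX *PS u))) +PS (ψ *PS (ψ ⧢PS u))
ψ*ρ-step-expand u =
  ≋-trans (*PS-distribˡ-+PS ψ ((ψ +PS log1+ħbX) *PS u) (ψ ⧢PS u))
    (+PS-cong (≋-trans (*PS-congʳ ψ (*PS-distribʳ-+PS u ψ log1+ħbX))
                       (*PS-distribˡ-+PS ψ (ψ *PS u) (log1+ħbX *PS u)))
              (≋-refl {ψ *PS (ψ ⧢PS u)}))

ψ⧢ψ*≋ψ*ρ-step : ∀ u → ψ ⧢PS (ψ *PS u) ≋ ψ *PS ρ-step u
ψ⧢ψ*≋ψ*ρ-step u = ≋-trans (mk≋ λ n → mk≃ (reorder n)) (≋-sym (ψ*ρ-step-expand u))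
  where
  T₁ T₂ T₃ : Functional → ℕ → ℕ → ℕ → ℚ
  T₁ g i j l = ⟪ ψ j · (ψ i ⧢ u l) , g ⟫
  T₂ g i j l = ⟪ ψ i · (ψ j · u l) , g ⟫
  T₃ g i j l = ⟪ ψ j · (log1+ħbX i · u l) , g ⟫
  reorder : ∀ n g → ⟪ (ψ ⧢PS (ψ *PS u)) n , g ⟫ ≡
    ⟪ (((ψ *PS (ψ *PS u)) +PS (ψ *PS (log1+ħbX *PS u))) +PS (ψ *PS (ψ ⧢PS u))) n , g ⟫
  reorder n g =
    begin
      ⟪ (ψ ⧢PS (ψ *PS u)) n , g ⟫
    ≡⟨ pair-convolution-nested ⧢-linearʳ _·_ ψ ψ u n g ⟩
      sumTriples n (λ i j l → ⟪ ψ i ⧢ (ψ j · u l) , g ⟫)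
    ≡⟨ sumTriples-cong n (λ i j l → trans (pair≡ (ψ-⧢-ψ· i j (u l)) g)
         (trans (pair-++ (ψ j · (ψ i ⧢ u l)) _ g)
           (cong (_+_ (T₁ g i j l)) (pair-++ (ψ i · (ψ j · u l)) (ψ j · (log1+ħbX i · u l)) g)))) ⟩
      sumTriples n (λ i j l → T₁ g i j l + (T₂ g i j l + T₃ g i j l))
    ≡⟨ trans (sumTriples-+ n (T₁ g) (λ i j l → T₂ g i j l + T₃ g i j l))
             (cong (_+_ (sumTriples n (T₁ g))) (sumTriples-+ n (T₂ g) (T₃ g))) ⟩
      sumTriples n (T₁ g) + (sumTriples n (T₂ g) + sumTriples n (T₃ g))
    ≡⟨ cong₂ (λ x y → x + (sumTriples n (T₂ g) + y)) (sumTriples-swap n (T₁ g)) (sumTriples-swap n (T₃ g)) ⟩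
      sumTriples n (λ i j l → T₁ g j i l) + (sumTriples n (T₂ g) + sumTriples n (λ i j l → T₃ g j i l))
    ≡⟨ ℚP.+-comm (sumTriples n (λ i j l → T₁ g j i l)) _ ⟩
      (sumTriples n (T₂ g) + sumTriples n (λ i j l → T₃ g j i l)) + sumTriples n (λ i j l → T₁ g j i l)
    ≡⟨ sym (trans (pair-++ (((ψ *PS (ψ *PS u)) +PS (ψ *PS (log1+ħbX *PS u))) n) _ g) (cong₂ _+_
         (trans (pair-++ ((ψ *PS (ψ *PS u)) n) _ g)
           (cong₂ _+_ (pair-convolution-nested ·-linearʳ _·_ ψ ψ u n g)
                      (pair-convolution-nested ·-linearʳ _·_ ψ log1+ħbX u n g)))
         (pair-convolution-nested ·-linearʳ _⧢_ ψ ψ u n g))) ⟩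
      ⟪ (((ψ *PS (ψ *PS u)) +PS (ψ *PS (log1+ħbX *PS u))) +PS (ψ *PS (ψ ⧢PS u))) n , g ⟫
    ∎
    where open ≡-Reasoning

ρ-step-⧢ : ∀ r w →
  ρ-step r ⧢PS w ≋ ((ψ *PS r) ⧢PS w) +PS ((log1+ħbX *PS (r ⧢PS w)) +PS (ψ ⧢PS (r ⧢PS w)))
ρ-step-⧢ r w =
  begin
    ρ-step r ⧢PS w
  ≈⟨ ⧢PS-distribʳ-+PS w ((ψ +PS log1+ħbX) *PS r) (ψ ⧢PS r) ⟩
    (((ψ +PS log1+ħbX) *PS r) ⧢PS w) +PS ((ψ ⧢PS r) ⧢PS w)
  ≈⟨ +PS-cong (≋-trans (⧢PS-congˡ w (*PS-distribʳ-+PS r ψ log1+ħbX))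
                       (⧢PS-distribʳ-+PS w (ψ *PS r) (log1+ħbX *PS r)))
              (ψ⧢-⧢-assoc r w) ⟩
    (((ψ *PS r) ⧢PS w) +PS ((log1+ħbX *PS r) ⧢PS w)) +PS (ψ ⧢PS (r ⧢PS w))
  ≈⟨ +PS-cong (+PS-cong (≋-refl {(ψ *PS r) ⧢PS w}) (log*-⧢-assoc r w)) (≋-refl {ψ ⧢PS (r ⧢PS w)}) ⟩
    (((ψ *PS r) ⧢PS w) +PS (log1+ħbX *PS (r ⧢PS w))) +PS (ψ ⧢PS (r ⧢PS w))
  ≈⟨ +PS-assoc ((ψ *PS r) ⧢PS w) (log1+ħbX *PS (r ⧢PS w)) (ψ ⧢PS (r ⧢PS w)) ⟩
    ((ψ *PS r) ⧢PS w) +PS ((log1+ħbX *PS (r ⧢PS w)) +PS (ψ ⧢PS (r ⧢PS w)))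
  ∎
  where open SetoidReasoning ≋-setoid

D-step : ∀ r w →
  D (((ψ *PS r) ⧢PS w) -PS (ψ *PS (r ⧢PS w))) ≋ ((ψ *PS ρ-step r) ⧢PS w) -PS (ψ *PS (ρ-step r ⧢PS w))
D-step r w =
  begin
    D (a⧢w -PS (ψ *PS u))
  ≈⟨ D≋ψ⧢-ψ* (a⧢w -PS (ψ *PS u)) ⟩
    (ψ ⧢PS (a⧢w -PS (ψ *PS u))) -PS (ψ *PS (a⧢w -PS (ψ *PS u)))
  ≈⟨ -PS-cong (⧢PS-distribˡ--PS ψ a⧢w (ψ *PS u)) (*PS-distribˡ--PS ψ a⧢w (ψ *PS u)) ⟩
    ((ψ ⧢PS a⧢w) -PS (ψ ⧢PS (ψ *PS u))) -PS ((ψ *PS a⧢w) -PS (ψ *PS (ψ *PS u)))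
  ≈⟨ -PS-cong (-PS-cong (≋-refl {ψ ⧢PS a⧢w}) (≋-trans (ψ⧢ψ*≋ψ*ρ-step u) (ψ*ρ-step-expand u)))
              (≋-refl {(ψ *PS a⧢w) -PS (ψ *PS (ψ *PS u))}) ⟩
    ((ψ ⧢PS a⧢w) -PS (((ψ *PS (ψ *PS u)) +PS (ψ *PS (log1+ħbX *PS u))) +PS (ψ *PS (ψ ⧢PS u))))
      -PS ((ψ *PS a⧢w) -PS (ψ *PS (ψ *PS u)))
  ≈⟨ -PS-cancel (ψ ⧢PS a⧢w) (ψ *PS (ψ *PS u)) (ψ *PS (log1+ħbX *PS u)) (ψ *PS (ψ ⧢PS u)) (ψ *PS a⧢w) ⟩
    (ψ ⧢PS a⧢w) -PS ((ψ *PS a⧢w) +PS ((ψ *PS (log1+ħbX *PS u)) +PS (ψ *PS (ψ ⧢PS u))))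
  ≈⟨ -PS-cong (≋-sym (≋-trans (⧢PS-congˡ w (≋-sym (ψ⧢ψ*≋ψ*ρ-step r))) (ψ⧢-⧢-assoc (ψ *PS r) w)))
              (≋-sym (≋-trans (*PS-congʳ ψ (ρ-step-⧢ r w))
                              (≋-trans (*PS-distribˡ-+PS ψ a⧢w ((log1+ħbX *PS u) +PS (ψ ⧢PS u)))
                                       (+PS-cong (≋-refl {ψ *PS a⧢w})
                                                 (*PS-distribˡ-+PS ψ (log1+ħbX *PS u) (ψ ⧢PS u)))))) ⟩
    ((ψ *PS ρ-step r) ⧢PS w) -PS (ψ *PS (ρ-step r ⧢PS w))
  ∎
  where
  open SetoidReasoning ≋-setoid
  a⧢w = (ψ *PS r) ⧢PS w
  u = r ⧢PS w

ψ*ρ≋shPow : ∀ s → ψ *PS ρ (suc s) ≋ shPow ψ (suc s)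
ψ*ρ≋shPow zero = ≋-trans (*PS-identityʳ ψ) (≋-sym (⧢PS-identityʳ ψ))
ψ*ρ≋shPow (suc s) = ≋-trans (≋-sym (ψ⧢ψ*≋ψ*ρ-step (ρ (suc s)))) (⧢PS-congʳ ψ (ψ*ρ≋shPow s))

iter-D≋ : ∀ s w → iter D (suc s) w ≋ ((ψ *PS ρ (suc s)) ⧢PS w) -PS (ψ *PS (ρ (suc s) ⧢PS w))
iter-D≋ zero w =
  ≋-trans (D≋ψ⧢-ψ* w)
    (-PS-cong (⧢PS-congˡ w (≋-sym (*PS-identityʳ ψ))) (*PS-congʳ ψ (≋-sym (⧢PS-identityˡ w))))
iter-D≋ (suc s) w = ≋-trans (D-cong (iter-D≋ s w)) (D-step (ρ (suc s)) w)

≋⇒≈ : ∀ {f h} → f ≋ h → f ≈ h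
≋⇒≈ {f} {h} p n w k = trans (coeff≡pair (f n)) (trans (pair≡ (coeff≃ p n) (δ w k)) (sym (coeff≡pair (h n))))
  where
  δ : Word → ℤ → Functional
  δ w k u j = if ⌊ u ≟W w ⌋ ∧ ⌊ j ℤ.≟ k ⌋ then 1ℚ else 0ℚ
  coeff≡pair : ∀ x → coeff x w k ≡ ⟪ x , δ w k ⟫
  coeff≡pair [] = refl
  coeff≡pair ((q , j , u) ∷ x) = cong₂ _+_ (if-*-indicator (⌊ u ≟W w ⌋ ∧ ⌊ j ℤ.≟ k ⌋)) (coeff≡pair x)
    where
    if-*-indicator : ∀ b → (if b then q else 0ℚ) ≡ q * (if b then 1ℚ else 0ℚ)
    if-*-indicator true = sym (ℚP.*-identityʳ q)
    if-*-indicator false = sym (ℚP.*-zeroʳ q)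

lemma3p6 : ((s : ℕ) → 1 ≤ s → (w : PS) →
             iter D s w ≈ (((ψ *PS ρ s) ⧢PS w) -PS (ψ *PS (ρ s ⧢PS w))))
           × ((s : ℕ) → 1 ≤ s → (ψ *PS ρ s) ≈ shPow ψ s)
lemma3p6 = (λ { (suc s) _ w → ≋⇒≈ (iter-D≋ s w) }) , (λ { (suc s) _ → ≋⇒≈ (ψ*ρ≋shPow s) })
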